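{- Let $\mathcal{M}$ be a multiset of $15$ lines (codelines) in $\mathrm{PG}(9,2)$ such that no hyperplane contains more than $6$ of those lines (in the multiset sense). Let $U$ be a $V_6$ of weight $10$ containing three codelines $L_1,L_2,L_3$ and an isolated codepoint (a codepoint of $U$ not on $L_1,L_2,L_3$), and let $\Pi_U\cong\mathrm{PG}(3,2)$ be its factor space with point weights as defined below. Then every point of $\Pi_U$ has weight $1$, $2$ or $3$.
   Context: The lines of $\mathcal{M}$ are called codelines; a point is a codepoint if it lies on some codeline. For a subspace $W$ of $\mathrm{PG}(9,2)$, its weight $w(W)$ is the number of codepoints in $W$. $V_n$ denotes a subspace of vector-space dimension $n$. For a subspace $U$ which is a $V_i$, the factor space $\Pi_U\cong\mathrm{PG}(9-i,2)$ has as points the $V_{i+1}$'s containing $U$; for a point $P$ of $\Pi_U$ write $\langle U,P\rangle$ for the corresponding $V_{i+1}$ and define $w(P)=w(\langle U,P\rangle)-w(U)$. -}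

module Defs where

open import Data.Nat using (ℕ; zero; suc; _+_; _^_; _≤_)
open import Data.Bool using (Bool; true; false; _∧_; _∨_; not; if_then_else_; _xor_)
open import Data.Vec using (Vec; []; _∷_; replicate; zipWith)
open import Data.List using (List; []; _∷_; _++_; map; allFin)
open import Data.Fin using (Fin)
open import Relation.Binary.PropositionalEquality using (_≡_)
open import Data.Product using (Σ; _×_; proj₁)

-- Ambient vector space F_2^10; PG(9,2) = its nonzero vectors.
Vector : Set
Vector = Vec Bool 10

_⊕_ : ∀ {n} → Vec Bool n → Vec Bool n → Vec Bool n
_⊕_ = zipWith _xor_

zeroV : Vector
zeroV = replicate 10 false

isZero : ∀ {n} → Vec Bool n → Bool
isZero [] = true
isZero (x ∷ v) = not x ∧ isZero v

eqV : ∀ {n} → Vec Bool n → Vec Bool n → Bool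
eqV [] [] = true
eqV (x ∷ u) (y ∷ v) = not (x xor y) ∧ eqV u v

allVecs : (n : ℕ) → List (Vec Bool n)
allVecs zero = [] ∷ []
allVecs (suc n) = map (false ∷_) (allVecs n) ++ map (true ∷_) (allVecs n)

count : ∀ {A : Set} → (A → Bool) → List A → ℕ
count p [] = 0
count p (x ∷ xs) = if p x then suc (count p xs) else count p xs

size : (Vector → Bool) → ℕ
size p = count p (allVecs 10)

-- A V_d : a vector subspace of F_2^10 of (vector-space) dimension d,
-- given by its characteristic function: contains 0, closed under +,
-- and has exactly 2^d elements.
IsSubspace : (Vector → Bool) → ℕ → Set
IsSubspace mem d =
  (mem zeroV ≡ true)
  × (∀ u v → mem u ≡ true → mem v ≡ true → mem (u ⊕ v) ≡ true)
  × (size mem ≡ 2 ^ d)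

Subspace : ℕ → Set
Subspace d = Σ (Vector → Bool) (λ m → IsSubspace m d)

mem : ∀ {d} → Subspace d → Vector → Bool
mem S = proj₁ S

_⊆_ : ∀ {d e} → Subspace d → Subspace e → Set
U ⊆ W = ∀ v → proj₁ U v ≡ true → proj₁ W v ≡ true

-- A projective line of PG(9,2): spanned by two distinct nonzero vectors a, b;
-- its points are a, b, a+b.
record Line : Set where
  field
    pa   : Vector
    pb   : Vector
    pa≠0 : isZero pa ≡ false
    pb≠0 : isZero pb ≡ false
    pa≠pb : eqV pa pb ≡ false
open Line public

onLine : Line → Vector → Bool
onLine L v = eqV v (pa L) ∨ eqV v (pb L) ∨ eqV v (pa L ⊕ pb L)

lineIn : ∀ {d} → Line → Subspace d → Bool
lineIn L S = proj₁ S (pa L) ∧ proj₁ S (pb L)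

Multiset15 : Set
Multiset15 = Fin 15 → Line

anyFin : ∀ {n} → (Fin n → Bool) → Bool
anyFin {n} p = go (allFin n)
  where
  go : List (Fin n) → Bool
  go [] = false
  go (i ∷ is) = p i ∨ go is

isCodepoint : Multiset15 → Vector → Bool
isCodepoint M v = not (isZero v) ∧ anyFin (λ i → onLine (M i) v)

weight : ∀ {d} → Multiset15 → Subspace d → ℕ
weight M S = count (λ v → proj₁ S v ∧ isCodepoint M v) (allVecs 10)

linesIn : ∀ {d} → Multiset15 → Subspace d → ℕ
linesIn {d} M S = count (λ i → lineIn {d} (M i) S) (allFin 15)

module Submission where

-- We work in F₂ⁿ with 2ⁿ = 1024 and describe hyperplanes by nonzero
-- functionals c (the hyperplane is ker c, with c·v the GF(2) dot product).
-- The proof is a double count of incidences "codeline ⊆ ker c" over the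
-- functionals c of the annihilator W^⊥ (8 of them) and of U^⊥ ∖ W^⊥ (8 more).
--   * Duality: |S|·|S^⊥| = 2ⁿ for every subspace S (halving principle for a
--     linear functional on a subspace), so |U^⊥| = 16 and |W^⊥| = 8.
--   * Line lemma: if X is a subspace of functionals of size 4q annihilating a
--     set Z, then a line meeting Z in m points lies in ≥ q(1+m) of the ker c, c ∈ X.
--   * Upper bound: each ker c, c ≠ 0, contains ≤ 6 codelines, so
--     Σ_L 2(1 + |L∩W|) ≤ 6·7 + 15 = 57 (c = 0 is one of the 8); as Σ_L |L∩U| ≥ 10 (three codelines of U
--     and the codeline through the isolated point), Σ_L |L ∩ (W∖U)| ≤ 3.
--   * Lower bound: if W∖U had no codepoint, every codeline L would lie in
--     ≥ 2(1 + |L∩U|) hyperplanes through U but not through W; summing over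
--     these 8 hyperplanes gives 2(15 + 10) ≤ 48, which is absurd.

open import Defs
open import Algebra.Bundles using (CommutativeRing)
open import Data.Bool using (Bool; true; false; _∧_; _∨_; not; if_then_else_; _xor_)
open import Data.Bool.Properties
  using (∧-comm; ∧-assoc; ∧-identityʳ; ∧-zeroʳ; xor-comm; xor-assoc; xor-same;
         xor-identityʳ; ∧-distribˡ-xor; ∧-distribʳ-xor; ¬-not; xor-∧-commutativeRing)
open import Data.Empty using (⊥; ⊥-elim)
open import Data.Fin using (Fin) renaming (zero to fzero; suc to fsuc)
open import Data.List using (List; []; _∷_; _++_; map; allFin; tabulate; length)
open import Data.List.Membership.Propositional using (_∈_)
open import Data.List.Membership.Propositional.Properties using (∈-map⁺; ∈-++⁺ˡ; ∈-++⁺ʳ; ∈-allFin)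
open import Data.List.Properties using (length-++; length-map; length-tabulate)
open import Data.List.Relation.Unary.All using (All; []; _∷_)
open import Data.List.Relation.Unary.Any using (here; there)
open import Data.List.Relation.Unary.AllPairs using ([]; _∷_)
open import Data.List.Relation.Unary.Unique.Propositional using (Unique)
open import Data.Nat using (ℕ; zero; suc; _+_; _*_; _^_; _≤_; _<_; z≤n; s≤s; _≤?_)
open import Data.Nat.Properties
open import Data.Product using (Σ; _×_; _,_; proj₁; proj₂)
open import Data.Sum using (_⊎_; inj₁; inj₂)
open import Data.Vec using (Vec; []; _∷_; replicate)
open import Relation.Binary.PropositionalEquality
  using (_≡_; _≢_; refl; sym; trans; cong; cong₂; subst; subst₂; module ≡-Reasoning)
open import Relation.Nullary using (yes; no)

open import Algebra.Properties.CommutativeSemigroup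
  (CommutativeRing.+-commutativeSemigroup xor-∧-commutativeRing)
  using () renaming (interchange to xor-interchange)
open import Algebra.Properties.CommutativeSemigroup +-commutativeSemigroup
  using () renaming (interchange to +-interchange)

∧-intro : ∀ {a b : Bool} → a ≡ true → b ≡ true → a ∧ b ≡ true
∧-intro refl refl = refl

∧-projˡ : ∀ {a b : Bool} → a ∧ b ≡ true → a ≡ true
∧-projˡ {true} _ = refl

∧-projʳ : ∀ {a b : Bool} → a ∧ b ≡ true → b ≡ true
∧-projʳ {true} e = e

∨-introˡ : ∀ {a b : Bool} → a ≡ true → a ∨ b ≡ true
∨-introˡ refl = refl

∨-introʳ : ∀ {a b : Bool} → b ≡ true → a ∨ b ≡ true
∨-introʳ {true} _ = refl
∨-introʳ {false} e = e

∨-elim : ∀ {a b : Bool} → a ∨ b ≡ true → a ≡ true ⊎ b ≡ true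
∨-elim {true} _ = inj₁ refl
∨-elim {false} e = inj₂ e

not-true : ∀ {a : Bool} → not a ≡ true → a ≡ false
not-true {false} _ = refl

not-false : ∀ {a : Bool} → a ≡ false → not a ≡ true
not-false refl = refl

true≢false : true ≢ false
true≢false ()

⇔-≡ : ∀ {a b : Bool} → (a ≡ true → b ≡ true) → (b ≡ true → a ≡ true) → a ≡ b
⇔-≡ {true} {true} _ _ = refl
⇔-≡ {true} {false} f _ = sym (f refl)
⇔-≡ {false} {true} _ g = g refl
⇔-≡ {false} {false} _ _ = refl

xor-false : ∀ {x y : Bool} → x ≡ false → y ≡ false → x xor y ≡ false
xor-false refl refl = refl

xor-false⇒≡ : ∀ {x y : Bool} → x xor y ≡ false → x ≡ y
xor-false⇒≡ {true} {true} _ = refl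
xor-false⇒≡ {false} {false} _ = refl

ind : Bool → ℕ
ind true = 1
ind false = 0

0ᵥ : ∀ n → Vec Bool n
0ᵥ n = replicate n false

⊕-comm : ∀ {n} (u v : Vec Bool n) → u ⊕ v ≡ v ⊕ u
⊕-comm [] [] = refl
⊕-comm (x ∷ u) (y ∷ v) = cong₂ _∷_ (xor-comm x y) (⊕-comm u v)

⊕-assoc : ∀ {n} (u v w : Vec Bool n) → (u ⊕ v) ⊕ w ≡ u ⊕ (v ⊕ w)
⊕-assoc [] [] [] = refl
⊕-assoc (x ∷ u) (y ∷ v) (z ∷ w) = cong₂ _∷_ (xor-assoc x y z) (⊕-assoc u v w)

⊕-self : ∀ {n} (u : Vec Bool n) → u ⊕ u ≡ 0ᵥ n
⊕-self [] = refl
⊕-self (x ∷ u) = cong₂ _∷_ (xor-same x) (⊕-self u)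

⊕-identityʳ : ∀ {n} (u : Vec Bool n) → u ⊕ 0ᵥ n ≡ u
⊕-identityʳ [] = refl
⊕-identityʳ (x ∷ u) = cong₂ _∷_ (xor-identityʳ x) (⊕-identityʳ u)

⊕-cancel : ∀ {n} (u s : Vec Bool n) → (u ⊕ s) ⊕ s ≡ u
⊕-cancel {n} u s = begin
  (u ⊕ s) ⊕ s  ≡⟨ ⊕-assoc u s s ⟩
  u ⊕ (s ⊕ s)  ≡⟨ cong (u ⊕_) (⊕-self s) ⟩
  u ⊕ 0ᵥ n     ≡⟨ ⊕-identityʳ u ⟩
  u            ∎
  where open ≡-Reasoning

⊕-cancelˡ : ∀ {n} (s u : Vec Bool n) → (s ⊕ u) ⊕ s ≡ u
⊕-cancelˡ s u = trans (cong (_⊕ s) (⊕-comm s u)) (⊕-cancel u s)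

dot : ∀ {n} → Vec Bool n → Vec Bool n → Bool
dot [] [] = false
dot (x ∷ c) (y ∷ v) = (x ∧ y) xor dot c v

dot-linearʳ : ∀ {n} (c u v : Vec Bool n) → dot c (u ⊕ v) ≡ dot c u xor dot c v
dot-linearʳ [] [] [] = refl
dot-linearʳ (x ∷ c) (y ∷ u) (z ∷ v) = begin
  (x ∧ (y xor z)) xor dot c (u ⊕ v)
    ≡⟨ cong₂ _xor_ (∧-distribˡ-xor x y z) (dot-linearʳ c u v) ⟩
  ((x ∧ y) xor (x ∧ z)) xor (dot c u xor dot c v)
    ≡⟨ xor-interchange (x ∧ y) (x ∧ z) (dot c u) (dot c v) ⟩
  ((x ∧ y) xor dot c u) xor ((x ∧ z) xor dot c v) ∎
  where open ≡-Reasoning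

dot-linearˡ : ∀ {n} (c c' v : Vec Bool n) → dot (c ⊕ c') v ≡ dot c v xor dot c' v
dot-linearˡ [] [] [] = refl
dot-linearˡ (x ∷ c) (y ∷ c') (z ∷ v) = begin
  ((x xor y) ∧ z) xor dot (c ⊕ c') v
    ≡⟨ cong₂ _xor_ (∧-distribʳ-xor z x y) (dot-linearˡ c c' v) ⟩
  ((x ∧ z) xor (y ∧ z)) xor (dot c v xor dot c' v)
    ≡⟨ xor-interchange (x ∧ z) (y ∧ z) (dot c v) (dot c' v) ⟩
  ((x ∧ z) xor dot c v) xor ((y ∧ z) xor dot c' v) ∎
  where open ≡-Reasoning

dot-comm : ∀ {n} (c v : Vec Bool n) → dot c v ≡ dot v c
dot-comm [] [] = refl
dot-comm (x ∷ c) (y ∷ v) = cong₂ _xor_ (∧-comm x y) (dot-comm c v)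

dot-zeroʳ : ∀ {n} (c : Vec Bool n) → dot c (0ᵥ n) ≡ false
dot-zeroʳ [] = refl
dot-zeroʳ (x ∷ c) = cong₂ _xor_ (∧-zeroʳ x) (dot-zeroʳ c)

sumL : ∀ {A : Set} → (A → ℕ) → List A → ℕ
sumL f [] = 0
sumL f (x ∷ xs) = f x + sumL f xs

sumL-ext : ∀ {A : Set} {f g : A → ℕ} → (∀ x → f x ≡ g x) → ∀ xs → sumL f xs ≡ sumL g xs
sumL-ext e [] = refl
sumL-ext e (x ∷ xs) = cong₂ _+_ (e x) (sumL-ext e xs)

sumL-mono : ∀ {A : Set} {f g : A → ℕ} → (∀ x → f x ≤ g x) → ∀ xs → sumL f xs ≤ sumL g xs
sumL-mono e [] = z≤n
sumL-mono e (x ∷ xs) = +-mono-≤ (e x) (sumL-mono e xs)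

sumL-zero : ∀ {A : Set} (xs : List A) → sumL (λ _ → 0) xs ≡ 0
sumL-zero [] = refl
sumL-zero (_ ∷ xs) = sumL-zero xs

sumL-const : ∀ {A : Set} (k : ℕ) (xs : List A) → sumL (λ _ → k) xs ≡ k * length xs
sumL-const k [] = sym (*-zeroʳ k)
sumL-const k (x ∷ xs) = trans (cong (k +_) (sumL-const k xs)) (sym (*-suc k (length xs)))

sumL-+ : ∀ {A : Set} (f g : A → ℕ) xs → sumL (λ x → f x + g x) xs ≡ sumL f xs + sumL g xs
sumL-+ f g [] = refl
sumL-+ f g (x ∷ xs) = trans (cong (f x + g x +_) (sumL-+ f g xs))
  (+-interchange (f x) (g x) (sumL f xs) (sumL g xs))

sumL-* : ∀ {A : Set} (k : ℕ) (f : A → ℕ) xs → sumL (λ x → k * f x) xs ≡ k * sumL f xs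
sumL-* k f [] = sym (*-zeroʳ k)
sumL-* k f (x ∷ xs) = trans (cong (k * f x +_) (sumL-* k f xs)) (sym (*-distribˡ-+ k (f x) (sumL f xs)))

sumL-swap : ∀ {A B : Set} (R : A → B → ℕ) xs ys →
  sumL (λ x → sumL (R x) ys) xs ≡ sumL (λ y → sumL (λ x → R x y) xs) ys
sumL-swap R [] ys = sym (sumL-zero ys)
sumL-swap R (x ∷ xs) ys = trans (cong (sumL (R x) ys +_) (sumL-swap R xs ys))
  (sym (sumL-+ (R x) (λ y → sumL (λ x' → R x' y) xs) ys))

count-ind : ∀ {A : Set} (p : A → Bool) xs → count p xs ≡ sumL (λ x → ind (p x)) xs
count-ind p [] = refl
count-ind p (x ∷ xs) with p x
... | true = cong suc (count-ind p xs)
... | false = count-ind p xs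

count-ext : ∀ {A : Set} {p q : A → Bool} → (∀ x → p x ≡ q x) → ∀ xs → count p xs ≡ count q xs
count-ext e [] = refl
count-ext e (x ∷ xs) rewrite e x | count-ext e xs = refl

count-false : ∀ {A : Set} (xs : List A) → count (λ _ → false) xs ≡ 0
count-false [] = refl
count-false (x ∷ xs) = count-false xs

count-++ : ∀ {A : Set} (p : A → Bool) xs ys → count p (xs ++ ys) ≡ count p xs + count p ys
count-++ p [] ys = refl
count-++ p (x ∷ xs) ys with p x
... | true = cong suc (count-++ p xs ys)
... | false = count-++ p xs ys

count-map : ∀ {A B : Set} (p : B → Bool) (g : A → B) xs → count p (map g xs) ≡ count (λ x → p (g x)) xs
count-map p g [] = refl
count-map p g (x ∷ xs) with p (g x)
... | true = cong suc (count-map p g xs)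
... | false = count-map p g xs

count-split : ∀ {A : Set} (p q : A → Bool) xs →
  count p xs ≡ count (λ x → p x ∧ q x) xs + count (λ x → p x ∧ not (q x)) xs
count-split p q [] = refl
count-split p q (x ∷ xs) with p x | q x
... | true | true = cong suc (count-split p q xs)
... | true | false = trans (cong suc (count-split p q xs)) (sym (+-suc _ _))
... | false | _ = count-split p q xs

count-mono : ∀ {A : Set} {p q : A → Bool} → (∀ x → p x ≡ true → q x ≡ true) → ∀ xs → count p xs ≤ count q xs
count-mono h [] = z≤n
count-mono {p = p} {q} h (x ∷ xs) with p x in e | q x in e'
... | true | true = s≤s (count-mono h xs)
... | true | false with () ← trans (sym e') (h x e)
... | false | true = m≤n⇒m≤1+n (count-mono h xs)
... | false | false = count-mono h xs

count-≤-length : ∀ {A : Set} (p : A → Bool) xs → count p xs ≤ length xs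
count-≤-length p [] = z≤n
count-≤-length p (x ∷ xs) with p x
... | true = s≤s (count-≤-length p xs)
... | false = m≤n⇒m≤1+n (count-≤-length p xs)

count-positive : ∀ {A : Set} (p : A → Bool) {x} xs → x ∈ xs → p x ≡ true → 1 ≤ count p xs
count-positive p (y ∷ xs) (here refl) e rewrite e = s≤s z≤n
count-positive p (y ∷ xs) (there m) e with p y
... | true = s≤s z≤n
... | false = count-positive p xs m e

count-witness : ∀ {A : Set} (p : A → Bool) xs → 1 ≤ count p xs → Σ A (λ x → p x ≡ true)
count-witness p (x ∷ xs) h with p x in e
... | true = x , e
... | false = count-witness p xs h

count-zero : ∀ {A : Set} (p : A → Bool) {x} xs → count p xs ≡ 0 → x ∈ xs → p x ≡ false
count-zero p (y ∷ xs) e m with p y in e'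
count-zero p (y ∷ xs) () m | true
count-zero p (y ∷ xs) e (here refl) | false = e'
count-zero p (y ∷ xs) e (there m) | false = count-zero p xs e m

count-∨ : ∀ {A : Set} (P Q R : A → Bool) xs →
  count (λ v → P v ∧ (Q v ∨ R v)) xs ≤ count (λ v → P v ∧ Q v) xs + count (λ v → P v ∧ R v) xs
count-∨ P Q R xs = begin
  count (λ v → P v ∧ (Q v ∨ R v)) xs
    ≡⟨ count-ind _ xs ⟩
  sumL (λ v → ind (P v ∧ (Q v ∨ R v))) xs
    ≤⟨ sumL-mono (λ v → ind-∨ (P v) (Q v) (R v)) xs ⟩
  sumL (λ v → ind (P v ∧ Q v) + ind (P v ∧ R v)) xs
    ≡⟨ sumL-+ _ _ xs ⟩
  sumL (λ v → ind (P v ∧ Q v)) xs + sumL (λ v → ind (P v ∧ R v)) xs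
    ≡⟨ sym (cong₂ _+_ (count-ind _ xs) (count-ind _ xs)) ⟩
  count (λ v → P v ∧ Q v) xs + count (λ v → P v ∧ R v) xs ∎
  where
  open ≤-Reasoning
  ind-∨ : ∀ p a b → ind (p ∧ (a ∨ b)) ≤ ind (p ∧ a) + ind (p ∧ b)
  ind-∨ false a b = z≤n
  ind-∨ true true b = s≤s z≤n
  ind-∨ true false b = ≤-refl

count-allVecs-suc : ∀ {n} (p : Vec Bool (suc n) → Bool) →
  count p (allVecs (suc n)) ≡ count (λ v → p (false ∷ v)) (allVecs n) + count (λ v → p (true ∷ v)) (allVecs n)
count-allVecs-suc {n} p = trans (count-++ p (map (false ∷_) (allVecs n)) (map (true ∷_) (allVecs n)))
  (cong₂ _+_ (count-map p (false ∷_) (allVecs n)) (count-map p (true ∷_) (allVecs n)))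

length-allVecs : ∀ n → length (allVecs n) ≡ 2 ^ n
length-allVecs zero = refl
length-allVecs (suc n) = begin
  length (map (false ∷_) (allVecs n) ++ map (true ∷_) (allVecs n))
    ≡⟨ length-++ (map (false ∷_) (allVecs n)) ⟩
  length (map (false ∷_) (allVecs n)) + length (map (true ∷_) (allVecs n))
    ≡⟨ cong₂ _+_ (length-map (false ∷_) (allVecs n)) (length-map (true ∷_) (allVecs n)) ⟩
  length (allVecs n) + length (allVecs n)
    ≡⟨ cong (λ m → m + m) (length-allVecs n) ⟩
  2 ^ n + 2 ^ n
    ≡⟨ cong (2 ^ n +_) (sym (+-identityʳ (2 ^ n))) ⟩
  2 ^ suc n ∎
  where open ≡-Reasoning

∈-allVecs : ∀ {n} (v : Vec Bool n) → v ∈ allVecs n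
∈-allVecs [] = here refl
∈-allVecs {suc n} (false ∷ v) = ∈-++⁺ˡ (∈-map⁺ (false ∷_) (∈-allVecs v))
∈-allVecs {suc n} (true ∷ v) = ∈-++⁺ʳ (map (false ∷_) (allVecs n)) (∈-map⁺ (true ∷_) (∈-allVecs v))

witness-or-none : ∀ {n} (p : Vec Bool n → Bool) → Σ (Vec Bool n) (λ v → p v ≡ true) ⊎ (∀ v → p v ≡ false)
witness-or-none {n} p with count p (allVecs n) in e
... | zero = inj₂ (λ v → count-zero p (allVecs n) e (∈-allVecs v))
... | suc k = inj₁ (count-witness p (allVecs n) (subst (1 ≤_) (sym e) (s≤s z≤n)))

count-translate : ∀ {n} (p : Vec Bool n → Bool) (s : Vec Bool n) →
  count p (allVecs n) ≡ count (λ v → p (v ⊕ s)) (allVecs n)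
count-translate {zero} p [] = refl
count-translate {suc n} p (false ∷ s) = begin
  count p (allVecs (suc n))
    ≡⟨ count-allVecs-suc p ⟩
  count (λ v → p (false ∷ v)) (allVecs n) + count (λ v → p (true ∷ v)) (allVecs n)
    ≡⟨ cong₂ _+_ (count-translate (λ v → p (false ∷ v)) s) (count-translate (λ v → p (true ∷ v)) s) ⟩
  count (λ v → p (false ∷ (v ⊕ s))) (allVecs n) + count (λ v → p (true ∷ (v ⊕ s))) (allVecs n)
    ≡⟨ sym (count-allVecs-suc (λ v → p (v ⊕ (false ∷ s)))) ⟩
  count (λ v → p (v ⊕ (false ∷ s))) (allVecs (suc n)) ∎
  where open ≡-Reasoning
count-translate {suc n} p (true ∷ s) = begin
  count p (allVecs (suc n))
    ≡⟨ count-allVecs-suc p ⟩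
  count (λ v → p (false ∷ v)) (allVecs n) + count (λ v → p (true ∷ v)) (allVecs n)
    ≡⟨ +-comm (count (λ v → p (false ∷ v)) (allVecs n)) _ ⟩
  count (λ v → p (true ∷ v)) (allVecs n) + count (λ v → p (false ∷ v)) (allVecs n)
    ≡⟨ cong₂ _+_ (count-translate (λ v → p (true ∷ v)) s) (count-translate (λ v → p (false ∷ v)) s) ⟩
  count (λ v → p (true ∷ (v ⊕ s))) (allVecs n) + count (λ v → p (false ∷ (v ⊕ s))) (allVecs n)
    ≡⟨ sym (count-allVecs-suc (λ v → p (v ⊕ (true ∷ s)))) ⟩
  count (λ v → p (v ⊕ (true ∷ s))) (allVecs (suc n)) ∎
  where open ≡-Reasoning

eqV-refl : ∀ {n} (a : Vec Bool n) → eqV a a ≡ true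
eqV-refl [] = refl
eqV-refl (true ∷ a) = eqV-refl a
eqV-refl (false ∷ a) = eqV-refl a

eqV-sound : ∀ {n} (u v : Vec Bool n) → eqV u v ≡ true → u ≡ v
eqV-sound [] [] e = refl
eqV-sound (true ∷ u) (true ∷ v) e = cong (true ∷_) (eqV-sound u v e)
eqV-sound (false ∷ u) (false ∷ v) e = cong (false ∷_) (eqV-sound u v e)

isZero-⊕ : ∀ {n} (a b : Vec Bool n) → isZero (a ⊕ b) ≡ eqV a b
isZero-⊕ [] [] = refl
isZero-⊕ (x ∷ a) (y ∷ b) = cong (not (x xor y) ∧_) (isZero-⊕ a b)

count-singleton : ∀ {n} (a : Vec Bool n) (P : Vec Bool n → Bool) →
  count (λ v → eqV v a ∧ P v) (allVecs n) ≡ ind (P a)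
count-singleton [] P with P []
... | true = refl
... | false = refl
count-singleton {suc n} (false ∷ a) P = trans (count-allVecs-suc (λ v → eqV v (false ∷ a) ∧ P v))
  (trans (cong₂ _+_ (count-singleton a (λ v → P (false ∷ v))) (count-false (allVecs n))) (+-identityʳ _))
count-singleton {suc n} (true ∷ a) P = trans (count-allVecs-suc (λ v → eqV v (true ∷ a) ∧ P v))
  (cong₂ _+_ (count-false (allVecs n)) (count-singleton a (λ v → P (true ∷ v))))

count-zero-vector : ∀ {n} (P : Vec Bool n → Bool) → count (λ v → P v ∧ isZero v) (allVecs n) ≡ ind (P (0ᵥ n))
count-zero-vector {n} P = trans (count-ext (λ v → trans (∧-comm (P v) (isZero v)) (cong (_∧ P v) (isZero-eqV v)))
  (allVecs n)) (count-singleton (0ᵥ n) P)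
  where
  isZero-eqV : ∀ {n} (v : Vec Bool n) → isZero v ≡ eqV v (0ᵥ n)
  isZero-eqV [] = refl
  isZero-eqV (true ∷ v) = refl
  isZero-eqV (false ∷ v) = isZero-eqV v

kernel-size : ∀ {n} (v : Vec Bool n) →
  count (λ c → not (dot c v)) (allVecs n) * 2 ≡ (if isZero v then 2 ^ suc n else 2 ^ n)
kernel-size [] = refl
kernel-size {suc n} (false ∷ v) = begin
  count (λ c → not (dot c (false ∷ v))) (allVecs (suc n)) * 2
    ≡⟨ cong (_* 2) (count-allVecs-suc (λ c → not (dot c (false ∷ v)))) ⟩
  (K + K) * 2
    ≡⟨ *-distribʳ-+ 2 K K ⟩
  K * 2 + K * 2
    ≡⟨ cong (λ t → t + t) (kernel-size v) ⟩
  rhs + rhs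
    ≡⟨ doubling (isZero v) ⟩
  (if isZero v then 2 ^ suc (suc n) else 2 ^ suc n) ∎
  where
  open ≡-Reasoning
  K : ℕ
  K = count (λ c → not (dot c v)) (allVecs n)
  rhs : ℕ
  rhs = if isZero v then 2 ^ suc n else 2 ^ n
  doubling : ∀ b → (if b then 2 ^ suc n else 2 ^ n) + (if b then 2 ^ suc n else 2 ^ n)
                   ≡ (if b then 2 ^ suc (suc n) else 2 ^ suc n)
  doubling true = cong (2 ^ suc n +_) (sym (+-identityʳ _))
  doubling false = cong (2 ^ n +_) (sym (+-identityʳ _))
kernel-size {suc n} (true ∷ v) = begin
  count (λ c → not (dot c (true ∷ v))) (allVecs (suc n)) * 2
    ≡⟨ cong (_* 2) (count-allVecs-suc (λ c → not (dot c (true ∷ v)))) ⟩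
  (count (λ c → not (dot c v)) (allVecs n) + count (λ c → not (not (dot c v))) (allVecs n)) * 2
    ≡⟨ cong (_* 2) (complement (λ c → not (dot c v)) (allVecs n)) ⟩
  length (allVecs n) * 2
    ≡⟨ cong (_* 2) (length-allVecs n) ⟩
  2 ^ n * 2
    ≡⟨ *-comm (2 ^ n) 2 ⟩
  2 ^ suc n ∎
  where
  open ≡-Reasoning
  complement : ∀ {A : Set} (p : A → Bool) xs → count p xs + count (λ x → not (p x)) xs ≡ length xs
  complement p [] = refl
  complement p (x ∷ xs) with p x
  ... | true = cong suc (complement p xs)
  ... | false = trans (+-suc _ _) (cong suc (complement p xs))

kernel-size-nonzero : ∀ {n} (c : Vec Bool n) (P : Vec Bool n → Bool) → (∀ v → P v ≡ not (dot c v)) →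
  isZero c ≡ false → count P (allVecs n) * 2 ≡ 2 ^ n
kernel-size-nonzero {n} c P P-def c≢0 = begin
  count P (allVecs n) * 2
    ≡⟨ cong (_* 2) (count-ext (λ v → trans (P-def v) (cong not (dot-comm c v))) (allVecs n)) ⟩
  count (λ v → not (dot v c)) (allVecs n) * 2
    ≡⟨ kernel-size c ⟩
  (if isZero c then 2 ^ suc n else 2 ^ n)
    ≡⟨ cong (λ z → if z then 2 ^ suc n else 2 ^ n) c≢0 ⟩
  2 ^ n ∎
  where open ≡-Reasoning

Closed : ∀ {n} → (Vec Bool n → Bool) → Set
Closed S = ∀ u v → S u ≡ true → S v ≡ true → S (u ⊕ v) ≡ true

Linear : ∀ {n} → (Vec Bool n → Bool) → Set
Linear f = ∀ u v → f (u ⊕ v) ≡ f u xor f v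

kernel-closed : ∀ {n} (S f : Vec Bool n → Bool) → Closed S → Linear f → Closed (λ v → S v ∧ not (f v))
kernel-closed S f cl lin u v hu hv = ∧-intro (cl u v (∧-projˡ hu) (∧-projˡ hv))
  (not-false (trans (lin u v) (xor-false (not-true (∧-projʳ {S u} hu)) (not-true (∧-projʳ {S v} hv)))))

-- If f(s) = 1 for some s ∈ S, translation by s swaps the two fibres of f on S,
-- so they have the same size.
fibres-equal : ∀ {n} (S f : Vec Bool n → Bool) → Closed S → Linear f → (s : Vec Bool n) → S s ≡ true → f s ≡ true →
  count (λ v → S v ∧ not (f v)) (allVecs n) ≡ count (λ v → S v ∧ f v) (allVecs n)
fibres-equal {n} S f cl lin s Ss fs = trans (count-translate (λ v → S v ∧ not (f v)) s) (count-ext swap (allVecs n))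
  where
  swap : ∀ v → (S (v ⊕ s) ∧ not (f (v ⊕ s))) ≡ (S v ∧ f v)
  swap v = cong₂ _∧_
    (⇔-≡ (λ h → subst (λ t → S t ≡ true) (⊕-cancel v s) (cl _ _ h Ss)) (λ h → cl _ _ h Ss))
    (trans (cong not (trans (lin v s) (cong (f v xor_) fs))) (not-xor-true (f v)))
    where
    not-xor-true : ∀ x → not (x xor true) ≡ x
    not-xor-true true = refl
    not-xor-true false = refl

kernel-half : ∀ {n} (S f : Vec Bool n → Bool) → Closed S → Linear f → (s : Vec Bool n) → S s ≡ true → f s ≡ true →
  count S (allVecs n) ≡ 2 * count (λ v → S v ∧ not (f v)) (allVecs n)
kernel-half {n} S f cl lin s Ss fs = begin
  count S (allVecs n)
    ≡⟨ count-split S f (allVecs n) ⟩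
  count (λ v → S v ∧ f v) (allVecs n) + K
    ≡⟨ cong (_+ K) (sym (fibres-equal S f cl lin s Ss fs)) ⟩
  K + K
    ≡⟨ cong (K +_) (sym (+-identityʳ K)) ⟩
  2 * K ∎
  where
  open ≡-Reasoning
  K : ℕ
  K = count (λ v → S v ∧ not (f v)) (allVecs n)

kernel-at-least-half : ∀ {n} (S f : Vec Bool n → Bool) → Closed S → Linear f →
  count S (allVecs n) ≤ 2 * count (λ v → S v ∧ not (f v)) (allVecs n)
kernel-at-least-half {n} S f cl lin with witness-or-none (λ v → S v ∧ f v)
... | inj₁ (s , e) = ≤-reflexive (kernel-half S f cl lin s (∧-projˡ e) (∧-projʳ {S s} e))
... | inj₂ none = begin
  count S (allVecs n)                            ≤⟨ m≤m+n _ _ ⟩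
  count S (allVecs n) + count S (allVecs n)      ≡⟨ cong (count S (allVecs n) +_) (sym (+-identityʳ _)) ⟩
  2 * count S (allVecs n)                        ≡⟨ cong (2 *_) (count-ext vanishes (allVecs n)) ⟩
  2 * count (λ v → S v ∧ not (f v)) (allVecs n)  ∎
  where
  open ≤-Reasoning
  vanishes : ∀ v → S v ≡ (S v ∧ not (f v))
  vanishes v with S v in e
  ... | false = refl
  ... | true = sym (not-false (trans (cong (_∧ f v) (sym e)) (none v)))


allOf : ∀ {A : Set} → (A → Bool) → List A → Bool
allOf p [] = true
allOf p (x ∷ xs) = p x ∧ allOf p xs

ann : ∀ {n} → (Vec Bool n → Bool) → Vec Bool n → Bool
ann {n} S c = allOf (λ v → not (S v) ∨ not (dot c v)) (allVecs n)

ann-sound : ∀ {n} (S : Vec Bool n → Bool) c v → ann S c ≡ true → S v ≡ true → dot c v ≡ false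
ann-sound {n} S c v h Sv = go (allVecs n) h (∈-allVecs v)
  where
  go : ∀ vs → allOf (λ v → not (S v) ∨ not (dot c v)) vs ≡ true → v ∈ vs → dot c v ≡ false
  go (w ∷ vs) h (here refl) with dot c w
  ... | false = refl
  ... | true rewrite Sv = ⊥-elim (true≢false (sym h))
  go (w ∷ vs) h (there m) = go vs (∧-projʳ {not (S w) ∨ not (dot c w)} h) m

ann-complete : ∀ {n} (S : Vec Bool n → Bool) c → (∀ v → S v ≡ true → dot c v ≡ false) → ann S c ≡ true
ann-complete {n} S c h = go (allVecs n)
  where
  go : ∀ vs → allOf (λ v → not (S v) ∨ not (dot c v)) vs ≡ true
  go [] = refl
  go (v ∷ vs) with S v in e
  ... | false = go vs
  ... | true rewrite h v e = go vs

ann-witness : ∀ {n} (S : Vec Bool n → Bool) c → ann S c ≡ false → Σ (Vec Bool n) (λ v → S v ≡ true × dot c v ≡ true)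
ann-witness S c h with witness-or-none (λ v → S v ∧ dot c v)
... | inj₁ (v , e) = v , ∧-projˡ e , ∧-projʳ {S v} e
... | inj₂ none = ⊥-elim (true≢false (trans (sym (ann-complete S c vanishes)) h))
  where
  vanishes : ∀ v → S v ≡ true → dot c v ≡ false
  vanishes v e = subst (λ t → t ∧ dot c v ≡ false) e (none v)

ann-closed : ∀ {n} (S : Vec Bool n → Bool) → Closed (ann S)
ann-closed S c c' h h' = ann-complete S (c ⊕ c')
  (λ v e → trans (dot-linearˡ c c' v) (xor-false (ann-sound S c v h e) (ann-sound S c' v h' e)))

orthogonalPairs : ∀ {n} → (Vec Bool n → Bool) → ℕ
orthogonalPairs {n} S = sumL (λ c → count (λ v → S v ∧ not (dot c v)) (allVecs n)) (allVecs n)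

-- counted by functionals: c ∈ S^⊥ sees all of S, any other c half of it
pairs-by-functional : ∀ {n} (S : Vec Bool n → Bool) → Closed S →
  2 * orthogonalPairs S ≡ 2 ^ n * count S (allVecs n) + count S (allVecs n) * count (ann S) (allVecs n)
pairs-by-functional {n} S cl = begin
  2 * orthogonalPairs S
    ≡⟨ sym (sumL-* 2 K V) ⟩
  sumL (λ c → 2 * K c) V
    ≡⟨ sumL-ext per-functional V ⟩
  sumL (λ c → |S| + |S| * ind (ann S c)) V
    ≡⟨ sumL-+ (λ _ → |S|) (λ c → |S| * ind (ann S c)) V ⟩
  sumL (λ _ → |S|) V + sumL (λ c → |S| * ind (ann S c)) V
    ≡⟨ cong₂ _+_ (sumL-const |S| V) (sumL-* |S| (λ c → ind (ann S c)) V) ⟩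
  |S| * length V + |S| * sumL (λ c → ind (ann S c)) V
    ≡⟨ cong₂ _+_ (trans (cong (|S| *_) (length-allVecs n)) (*-comm |S| (2 ^ n)))
                 (cong (|S| *_) (sym (count-ind (ann S) V))) ⟩
  2 ^ n * |S| + |S| * count (ann S) V ∎
  where
  open ≡-Reasoning
  V : List (Vec Bool n)
  V = allVecs n
  |S| : ℕ
  |S| = count S V
  K : Vec Bool n → ℕ
  K c = count (λ v → S v ∧ not (dot c v)) V
  per-functional : ∀ c → 2 * K c ≡ |S| + |S| * ind (ann S c)
  per-functional c with ann S c in e
  ... | true = trans (cong (2 *_) (count-ext all-of-S V))
                     (trans (cong (|S| +_) (+-identityʳ |S|)) (cong (|S| +_) (sym (*-identityʳ |S|))))
    where
    all-of-S : ∀ v → (S v ∧ not (dot c v)) ≡ S v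
    all-of-S v with S v in e'
    ... | false = refl
    ... | true rewrite ann-sound S c v e e' = refl
  ... | false = trans (sym (kernel-half S (dot c) cl (dot-linearʳ c) v Sv cv))
                      (trans (sym (+-identityʳ |S|)) (cong (|S| +_) (sym (*-zeroʳ |S|))))
    where
    w : Σ (Vec Bool n) (λ v → S v ≡ true × dot c v ≡ true)
    w = ann-witness S c e
    v : Vec Bool n
    v = proj₁ w
    Sv : S v ≡ true
    Sv = proj₁ (proj₂ w)
    cv : dot c v ≡ true
    cv = proj₂ (proj₂ w)

-- counted by vectors: 0 is orthogonal to all 2ⁿ functionals, any other v to half
pairs-by-vector : ∀ {n} (S : Vec Bool n → Bool) → S (0ᵥ n) ≡ true →
  2 * orthogonalPairs S ≡ 2 ^ n * count S (allVecs n) + 2 ^ n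
pairs-by-vector {n} S S0 = begin
  2 * orthogonalPairs S
    ≡⟨ cong (2 *_) (sumL-ext (λ c → count-ind _ V) V) ⟩
  2 * sumL (λ c → sumL (λ v → ind (S v ∧ not (dot c v))) V) V
    ≡⟨ cong (2 *_) (sumL-swap (λ c v → ind (S v ∧ not (dot c v))) V V) ⟩
  2 * sumL (λ v → sumL (λ c → ind (S v ∧ not (dot c v))) V) V
    ≡⟨ sym (sumL-* 2 _ V) ⟩
  sumL (λ v → 2 * sumL (λ c → ind (S v ∧ not (dot c v))) V) V
    ≡⟨ sumL-ext per-vector V ⟩
  sumL (λ v → 2 ^ n * (ind (S v) + ind (S v ∧ isZero v))) V
    ≡⟨ sumL-* (2 ^ n) _ V ⟩
  2 ^ n * sumL (λ v → ind (S v) + ind (S v ∧ isZero v)) V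
    ≡⟨ cong (2 ^ n *_) (sumL-+ (λ v → ind (S v)) (λ v → ind (S v ∧ isZero v)) V) ⟩
  2 ^ n * (sumL (λ v → ind (S v)) V + sumL (λ v → ind (S v ∧ isZero v)) V)
    ≡⟨ cong (λ t → 2 ^ n * (t + sumL (λ v → ind (S v ∧ isZero v)) V)) (sym (count-ind S V)) ⟩
  2 ^ n * (count S V + sumL (λ v → ind (S v ∧ isZero v)) V)
    ≡⟨ cong (λ t → 2 ^ n * (count S V + t)) (trans (sym (count-ind _ V)) only-zero) ⟩
  2 ^ n * (count S V + 1)
    ≡⟨ trans (*-distribˡ-+ (2 ^ n) (count S V) 1) (cong (2 ^ n * count S V +_) (*-identityʳ _)) ⟩
  2 ^ n * count S V + 2 ^ n ∎
  where
  open ≡-Reasoning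
  V : List (Vec Bool n)
  V = allVecs n
  only-zero : count (λ v → S v ∧ isZero v) V ≡ 1
  only-zero = trans (count-zero-vector S) (cong ind S0)
  per-vector : ∀ v → 2 * sumL (λ c → ind (S v ∧ not (dot c v))) V ≡ 2 ^ n * (ind (S v) + ind (S v ∧ isZero v))
  per-vector v with S v
  ... | false = trans (cong (2 *_) (sumL-zero V)) (sym (*-zeroʳ (2 ^ n)))
  ... | true = begin
    2 * sumL (λ c → ind (not (dot c v))) V ≡⟨ cong (2 *_) (sym (count-ind _ V)) ⟩
    2 * count (λ c → not (dot c v)) V      ≡⟨ *-comm 2 (count (λ c → not (dot c v)) V) ⟩
    count (λ c → not (dot c v)) V * 2      ≡⟨ kernel-size v ⟩
    (if isZero v then 2 ^ suc n else 2 ^ n) ≡⟨ as-multiple (isZero v) ⟩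
    2 ^ n * (1 + ind (isZero v)) ∎
    where
    as-multiple : ∀ b → (if b then 2 ^ suc n else 2 ^ n) ≡ 2 ^ n * (1 + ind b)
    as-multiple true = *-comm 2 (2 ^ n)
    as-multiple false = sym (*-identityʳ _)

duality : ∀ {n} (S : Vec Bool n → Bool) → Closed S → S (0ᵥ n) ≡ true →
  count S (allVecs n) * count (ann S) (allVecs n) ≡ 2 ^ n
duality {n} S cl S0 = +-cancelˡ-≡ (2 ^ n * count S (allVecs n)) _ _
  (trans (sym (pairs-by-functional S cl)) (pairs-by-vector S S0))

span : ∀ {n} → (Vec Bool n → Bool) → Vec Bool n → Vec Bool n → Bool
span S x v = S v ∨ S (v ⊕ x)

span-closed : ∀ {n} (S : Vec Bool n → Bool) x → Closed S → Closed (span S x)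
span-closed S x cl u v hu hv with ∨-elim {S u} hu | ∨-elim {S v} hv
... | inj₁ Su | inj₁ Sv = ∨-introˡ (cl u v Su Sv)
... | inj₁ Su | inj₂ Svx = ∨-introʳ (subst (λ t → S t ≡ true) (sym (⊕-assoc u v x)) (cl _ _ Su Svx))
... | inj₂ Sux | inj₁ Sv = ∨-introʳ (subst (λ t → S t ≡ true) (swap-right u x v) (cl _ _ Sux Sv))
  where
  swap-right : ∀ {n} (u x v : Vec Bool n) → (u ⊕ x) ⊕ v ≡ (u ⊕ v) ⊕ x
  swap-right u x v = trans (⊕-assoc u x v) (trans (cong (u ⊕_) (⊕-comm x v)) (sym (⊕-assoc u v x)))
... | inj₂ Sux | inj₂ Svx = ∨-introˡ (subst (λ t → S t ≡ true) (difference u v x) (cl _ _ Sux Svx))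
  where
  difference : ∀ {n} (u v x : Vec Bool n) → (u ⊕ x) ⊕ (v ⊕ x) ≡ u ⊕ v
  difference u v x = trans (sym (⊕-assoc (u ⊕ x) v x))
    (trans (cong (_⊕ x) (trans (⊕-assoc u x v) (trans (cong (u ⊕_) (⊕-comm x v)) (sym (⊕-assoc u v x)))))
           (⊕-cancel (u ⊕ v) x))

span-zero : ∀ {n} (S : Vec Bool n → Bool) x → S (0ᵥ n) ≡ true → span S x (0ᵥ n) ≡ true
span-zero S x S0 = ∨-introˡ S0

span-generator : ∀ {n} (S : Vec Bool n → Bool) x → S (0ᵥ n) ≡ true → span S x x ≡ true
span-generator S x S0 = ∨-introʳ {S x} (subst (λ t → S t ≡ true) (sym (⊕-self x)) S0)

span-size : ∀ {n} (S : Vec Bool n → Bool) x → Closed S → S x ≡ false →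
  count (span S x) (allVecs n) ≡ 2 * count S (allVecs n)
span-size {n} S x cl Sx = begin
  count (span S x) V
    ≡⟨ count-split (span S x) S V ⟩
  count (λ v → span S x v ∧ S v) V + count (λ v → span S x v ∧ not (S v)) V
    ≡⟨ cong₂ _+_ (count-ext inside V) (count-ext outside V) ⟩
  count S V + count (λ v → S (v ⊕ x)) V
    ≡⟨ cong (count S V +_) (sym (count-translate S x)) ⟩
  count S V + count S V
    ≡⟨ cong (count S V +_) (sym (+-identityʳ _)) ⟩
  2 * count S V ∎
  where
  open ≡-Reasoning
  V : List (Vec Bool n)
  V = allVecs n
  inside : ∀ v → (span S x v ∧ S v) ≡ S v
  inside v with S v
  ... | true = refl
  ... | false = ∧-zeroʳ (S (v ⊕ x))
  outside : ∀ v → (span S x v ∧ not (S v)) ≡ S (v ⊕ x)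
  outside v with S v in e
  ... | false = ∧-identityʳ (S (v ⊕ x))
  ... | true with S (v ⊕ x) in e'
  ...   | false = refl
  ...   | true = ⊥-elim (true≢false (trans (sym (subst (λ t → S t ≡ true) (⊕-cancelˡ v x) (cl _ _ e' e))) Sx))

ann-span : ∀ {n} (S : Vec Bool n → Bool) x → S (0ᵥ n) ≡ true → ∀ c →
  ann (span S x) c ≡ (ann S c ∧ not (dot c x))
ann-span S x S0 c = ⇔-≡ into from
  where
  into : ann (span S x) c ≡ true → (ann S c ∧ not (dot c x)) ≡ true
  into h = ∧-intro (ann-complete S c (λ v e → ann-sound (span S x) c v h (∨-introˡ e)))
                   (not-false (ann-sound (span S x) c x h (span-generator S x S0)))
  from : (ann S c ∧ not (dot c x)) ≡ true → ann (span S x) c ≡ true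
  from h = ann-complete (span S x) c vanishes
    where
    vanishes : ∀ v → span S x v ≡ true → dot c v ≡ false
    vanishes v e with ∨-elim {S v} e
    ... | inj₁ Sv = ann-sound S c v (∧-projˡ h) Sv
    ... | inj₂ Svx = trans (cong (dot c) (sym (⊕-cancel v x))) (trans (dot-linearʳ c (v ⊕ x) x)
           (xor-false (ann-sound S c (v ⊕ x) (∧-projˡ h) Svx) (not-true (∧-projʳ {ann S c} h))))

pointsIn : ∀ {n} → (Vec Bool n → Bool) → Vec Bool n → Vec Bool n → ℕ
pointsIn Z a b = ind (Z a) + ind (Z b) + ind (Z (a ⊕ b))

Kills : ∀ {n} → Vec Bool n → Vec Bool n → Vec Bool n → Bool
Kills a b c = not (dot c a) ∧ not (dot c b)

kills : ∀ {n} (a b c : Vec Bool n) → dot c a ≡ false → dot c b ≡ false → Kills a b c ≡ true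
kills a b c ca cb = cong₂ (λ s t → not s ∧ not t) ca cb

kills-elim : ∀ {n} (a b c : Vec Bool n) → Kills a b c ≡ true → dot c a ≡ false × dot c b ≡ false
kills-elim a b c h = not-true (∧-projˡ h) , not-true (∧-projʳ {not (dot c a)} h)

killers-closed : ∀ {n} (X : Vec Bool n → Bool) → Closed X → ∀ a b → Closed (λ c → X c ∧ Kills a b c)
killers-closed X cl a b u v hu hv = ∧-intro (cl u v (∧-projˡ hu) (∧-projˡ hv))
  (kills a b (u ⊕ v) (trans (dot-linearˡ u v a) (xor-false (proj₁ Ku) (proj₁ Kv)))
                     (trans (dot-linearˡ u v b) (xor-false (proj₂ Ku) (proj₂ Kv))))
  where
  Ku : dot u a ≡ false × dot u b ≡ false
  Ku = kills-elim a b u (∧-projʳ {X u} hu)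
  Kv : dot v a ≡ false × dot v b ≡ false
  Kv = kills-elim a b v (∧-projʳ {X v} hv)

module KillerBounds {n : ℕ} (X : Vec Bool n → Bool) (q : ℕ) (clX : Closed X)
                    (|X| : count X (allVecs n) ≡ 4 * q) (a b : Vec Bool n) where
  V : List (Vec Bool n)
  V = allVecs n

  killers : ℕ
  killers = count (λ c → X c ∧ Kills a b c) V

  -- killing a line means lying in the kernel of two functionals: a quarter survives
  quarter : q ≤ killers
  quarter = *-cancelˡ-≤ 4 (begin
      4 * q                                           ≡⟨ sym |X| ⟩
      count X V                                       ≤⟨ kernel-at-least-half X (λ c → dot c a) clX (λ u v → dot-linearˡ u v a) ⟩
      2 * count Xa V                                  ≤⟨ *-monoʳ-≤ 2 (kernel-at-least-half Xa (λ c → dot c b)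
                                                           (kernel-closed X (λ c → dot c a) clX (λ u v → dot-linearˡ u v a))
                                                           (λ u v → dot-linearˡ u v b)) ⟩
      2 * (2 * count (λ c → Xa c ∧ not (dot c b)) V)  ≡⟨ sym (*-assoc 2 2 (count (λ c → Xa c ∧ not (dot c b)) V)) ⟩
      4 * count (λ c → Xa c ∧ not (dot c b)) V        ≡⟨ cong (4 *_) (count-ext (λ c → ∧-assoc (X c) _ _) V) ⟩
      4 * killers                                     ∎)
    where
    open ≤-Reasoning
    Xa : Vec Bool n → Bool
    Xa c = X c ∧ not (dot c a)

  half : (y : Vec Bool n) → (∀ c → X c ≡ true → Kills a b c ≡ not (dot c y)) → 2 * q ≤ killers
  half y same = *-cancelˡ-≤ 2 (begin
      2 * (2 * q)                        ≡⟨ sym (*-assoc 2 2 q) ⟩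
      4 * q                              ≡⟨ sym |X| ⟩
      count X V                          ≤⟨ kernel-at-least-half X (λ c → dot c y) clX (λ u v → dot-linearˡ u v y) ⟩
      2 * count (λ c → X c ∧ not (dot c y)) V ≡⟨ cong (2 *_) (count-ext agree V) ⟩
      2 * killers                        ∎)
    where
    open ≤-Reasoning
    agree : ∀ c → (X c ∧ not (dot c y)) ≡ (X c ∧ Kills a b c)
    agree c with X c in e
    ... | false = refl
    ... | true = sym (same c e)

  whole : (∀ c → X c ≡ true → Kills a b c ≡ true) → 4 * q ≤ killers
  whole all-kill = ≤-reflexive (trans (sym |X|) (count-ext agree V))
    where
    agree : ∀ c → X c ≡ (X c ∧ Kills a b c)
    agree c with X c in e
    ... | false = refl
    ... | true = sym (all-kill c e)

dot-second : ∀ {n} (c a b : Vec Bool n) → dot c a ≡ false → dot c (a ⊕ b) ≡ false → dot c b ≡ false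
dot-second c a b ca cab = trans (cong (_xor dot c b) (sym ca)) (trans (sym (dot-linearʳ c a b)) cab)

dot-first : ∀ {n} (c a b : Vec Bool n) → dot c b ≡ false → dot c (a ⊕ b) ≡ false → dot c a ≡ false
dot-first c a b cb cab = trans (sym (xor-identityʳ (dot c a)))
  (trans (cong (dot c a xor_) (sym cb)) (trans (sym (dot-linearʳ c a b)) cab))

at-most-four : ∀ q x y z → q * (1 + (ind x + ind y + ind z)) ≤ 4 * q
at-most-four q x y z = ≤-trans (*-monoʳ-≤ q (s≤s (three x y z))) (≤-reflexive (*-comm q 4))
  where
  one : ∀ x → ind x ≤ 1
  one true = ≤-refl
  one false = z≤n
  three : ∀ x y z → ind x + ind y + ind z ≤ 3
  three x y z = +-mono-≤ (+-mono-≤ (one x) (one y)) (one z)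

line-lemma : ∀ {n} (X Z : Vec Bool n → Bool) (q : ℕ) → Closed X → count X (allVecs n) ≡ 4 * q →
  (∀ c v → X c ≡ true → Z v ≡ true → dot c v ≡ false) → (a b : Vec Bool n) →
  q * (1 + pointsIn Z a b) ≤ count (λ c → X c ∧ Kills a b c) (allVecs n)
line-lemma {n} X Z q clX |X| orth a b with Z a in za | Z b in zb | Z (a ⊕ b) in zab
... | false | false | false = subst (_≤ killers) (sym (*-identityʳ q)) quarter
  where open KillerBounds X q clX |X| a b
... | true | false | false = subst (_≤ killers) (*-comm 2 q) (half b same)
  where
  open KillerBounds X q clX |X| a b
  same : ∀ c → X c ≡ true → Kills a b c ≡ not (dot c b)
  same c Xc = cong (λ t → not t ∧ not (dot c b)) (orth c a Xc za)
... | false | true | false = subst (_≤ killers) (*-comm 2 q) (half a same)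
  where
  open KillerBounds X q clX |X| a b
  same : ∀ c → X c ≡ true → Kills a b c ≡ not (dot c a)
  same c Xc = trans (cong (λ t → not (dot c a) ∧ not t) (orth c b Xc zb)) (∧-identityʳ (not (dot c a)))
... | false | false | true = subst (_≤ killers) (*-comm 2 q) (half a same)
  where
  open KillerBounds X q clX |X| a b
  -- c kills a ⊕ b, so c·a = c·b
  same : ∀ c → X c ≡ true → Kills a b c ≡ not (dot c a)
  same c Xc = trans (cong (λ t → not (dot c a) ∧ not t) (sym ca≡cb)) (∧-idem (not (dot c a)))
    where
    ca≡cb : dot c a ≡ dot c b
    ca≡cb = xor-false⇒≡ (trans (sym (dot-linearʳ c a b)) (orth c (a ⊕ b) Xc zab))
    ∧-idem : ∀ x → x ∧ x ≡ x
    ∧-idem true = refl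
    ∧-idem false = refl
... | true | true | z = ≤-trans (at-most-four q true true z) (whole (λ c Xc → kills a b c (orth c a Xc za) (orth c b Xc zb)))
  where open KillerBounds X q clX |X| a b
... | true | false | true = ≤-trans (at-most-four q true false true) (whole (λ c Xc →
    kills a b c (orth c a Xc za) (dot-second c a b (orth c a Xc za) (orth c (a ⊕ b) Xc zab))))
  where open KillerBounds X q clX |X| a b
... | false | true | true = ≤-trans (at-most-four q false true true) (whole (λ c Xc →
    kills a b c (dot-first c a b (orth c b Xc zb) (orth c (a ⊕ b) Xc zab)) (orth c b Xc zb)))
  where open KillerBounds X q clX |X| a b

-- A vector x outside a subspace S is detected by some c ∈ S^⊥ with c·x = 1:
-- otherwise S + ⟨x⟩ would have twice the size of S but the same annihilator,
-- contradicting duality.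
separating-functional : ∀ {n} (S : Vec Bool n → Bool) x → Closed S → S (0ᵥ n) ≡ true → S x ≡ false →
  Σ (Vec Bool n) (λ c → (ann S c ∧ dot c x) ≡ true)
separating-functional {n} S x cl S0 Sx with witness-or-none (λ c → ann S c ∧ dot c x)
... | inj₁ c = c
... | inj₂ none = ⊥-elim (<-irrefl refl (subst (2 ^ n <_) doubled (m<m+n (2 ^ n) (m^n>0 2 n))))
  where
  V : List (Vec Bool n)
  V = allVecs n
  same-ann : ∀ c → ann (span S x) c ≡ ann S c
  same-ann c with ann S c in e
  ... | false = trans (ann-span S x S0 c) (cong (_∧ not (dot c x)) e)
  ... | true = trans (ann-span S x S0 c) (trans (cong (_∧ not (dot c x)) e)
                 (not-false (trans (cong (_∧ dot c x) (sym e)) (none c))))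
  doubled : 2 ^ n + 2 ^ n ≡ 2 ^ n
  doubled = begin
    2 ^ n + 2 ^ n                                      ≡⟨ cong (λ t → t + t) (sym (duality S cl S0)) ⟩
    count S V * count (ann S) V + count S V * count (ann S) V ≡⟨ sym (*-distribʳ-+ (count (ann S) V) (count S V) _) ⟩
    (count S V + count S V) * count (ann S) V          ≡⟨ cong₂ _*_ (trans (cong (count S V +_) (sym (+-identityʳ _)))
                                                                         (sym (span-size S x cl Sx)))
                                                                  (sym (count-ext same-ann V)) ⟩
    count (span S x) V * count (ann (span S x)) V      ≡⟨ duality (span S x) (span-closed S x cl) (span-zero S x S0) ⟩
    2 ^ n ∎
    where open ≡-Reasoning

module Flag {n : ℕ} (2ⁿ≡1024 : 2 ^ n ≡ 1024)
  (U W : Vec Bool n → Bool) (U0 : U (0ᵥ n) ≡ true) (U-closed : Closed U) (|U| : count U (allVecs n) ≡ 64)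
  (W-closed : Closed W) (|W| : count W (allVecs n) ≡ 128) (U⊆W : ∀ v → U v ≡ true → W v ≡ true) where

  V : List (Vec Bool n)

  V = allVecs n

  -- by duality |U^⊥| = 1024 / 64
  |U⊥| : count (ann U) V ≡ 16
  |U⊥| = *-cancelˡ-≡ (count (ann U) V) 16 64
    (trans (cong (_* count (ann U) V) (sym |U|)) (trans (duality U U-closed U0) 2ⁿ≡1024))

  fresh : Vec Bool n → Bool
  fresh v = W v ∧ not (U v)

  |W∖U| : count fresh V ≡ 64
  |W∖U| = +-cancelˡ-≡ 64 (count fresh V) 64 (begin
    64 + count fresh V                         ≡⟨ cong (_+ count fresh V) (sym (trans (count-ext W∩U V) |U|)) ⟩
    count (λ v → W v ∧ U v) V + count fresh V  ≡⟨ sym (count-split W U V) ⟩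
    count W V                                  ≡⟨ |W| ⟩
    128 ∎)
    where
    open ≡-Reasoning
    W∩U : ∀ v → (W v ∧ U v) ≡ U v
    W∩U v with U v in e
    ... | true rewrite U⊆W v e = refl
    ... | false = ∧-zeroʳ (W v)

  w-spec : Σ (Vec Bool n) (λ v → fresh v ≡ true)
  w-spec = count-witness fresh V (subst (1 ≤_) (sym |W∖U|) (s≤s z≤n))

  w : Vec Bool n
  w = proj₁ w-spec

  w∈W : W w ≡ true
  w∈W = ∧-projˡ (proj₂ w-spec)

  w∉U : U w ≡ false
  w∉U = not-true (∧-projʳ {W w} (proj₂ w-spec))

  |U+w| : count (span U w) V ≡ 128
  |U+w| = trans (span-size U w U-closed w∉U) (cong (2 *_) |U|)

  W-from : ∀ y z → W (y ⊕ z) ≡ true → W z ≡ true → W y ≡ true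
  W-from y z h1 h2 = subst (λ s → W s ≡ true) (⊕-cancel y z) (W-closed _ _ h1 h2)

  U+w⊆W : ∀ v → span U w v ≡ true → W v ≡ true
  U+w⊆W v h with ∨-elim {U v} h
  ... | inj₁ Uv = U⊆W v Uv
  ... | inj₂ Uvw = W-from v w (U⊆W _ Uvw) w∈W

  -- W = U ∪ (U + w): a vector of W outside both would span with U + ⟨w⟩ a
  -- subspace of W with 256 elements
  coset : ∀ v → W v ≡ true → U v ≡ false → U (v ⊕ w) ≡ true
  coset v Wv Uv = ¬-not too-big
    where
    too-big : U (v ⊕ w) ≡ false → ⊥
    too-big Uvw = ≤⇒≯ (subst₂ _≤_ |U+w+v| |W| (count-mono inside V)) (m≤m+n 129 127)
      where
      |U+w+v| : count (span (span U w) v) V ≡ 256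
      |U+w+v| = trans (span-size (span U w) v (span-closed U w U-closed) (cong₂ _∨_ Uv Uvw)) (cong (2 *_) |U+w|)
      inside : ∀ x → span (span U w) v x ≡ true → W x ≡ true
      inside x h with ∨-elim {span U w x} h
      ... | inj₁ h₁ = U+w⊆W x h₁
      ... | inj₂ h₂ = W-from x v (U+w⊆W _ h₂) Wv

  fresh-from-coset : ∀ y → U (w ⊕ y) ≡ true → fresh y ≡ true
  fresh-from-coset y h = ∧-intro Wy (not-false Uy)
    where
    Wy : W y ≡ true
    Wy = subst (λ s → W s ≡ true) (⊕-cancelˡ w y) (W-closed _ _ (U⊆W _ h) w∈W)
    Uy : U y ≡ false
    Uy = ¬-not (λ u → true≢false (trans (sym (subst (λ s → U s ≡ true) (⊕-cancel w y) (U-closed _ _ h u))) w∉U))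

  -- W^⊥ = U^⊥ ∩ w^⊥ : the 8 hyperplanes through W
  W⊥ : Vec Bool n → Bool
  W⊥ c = ann U c ∧ not (dot c w)

  -- U^⊥ ∖ W^⊥ : the 8 hyperplanes through U but not through W
  U⊥∖W⊥ : Vec Bool n → Bool
  U⊥∖W⊥ c = ann U c ∧ dot c w

  -- some hyperplane through U misses w, so w^⊥ halves U^⊥
  separating : Σ (Vec Bool n) (λ c → U⊥∖W⊥ c ≡ true)
  separating = separating-functional U w U-closed U0 w∉U

  |W⊥| : count W⊥ V ≡ 8
  |W⊥| = *-cancelˡ-≡ (count W⊥ V) 8 2 (trans (sym (kernel-half (ann U) (λ c → dot c w) (ann-closed U)
    (λ u v → dot-linearˡ u v w) c (∧-projˡ c-spec) (∧-projʳ {ann U c} c-spec))) |U⊥|)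
    where
    c : Vec Bool n
    c = proj₁ separating
    c-spec : U⊥∖W⊥ c ≡ true
    c-spec = proj₂ separating

  |U⊥∖W⊥| : count U⊥∖W⊥ V ≡ 8
  |U⊥∖W⊥| = trans (sym (fibres-equal (ann U) (λ c → dot c w) (ann-closed U) (λ u v → dot-linearˡ u v w)
    (proj₁ separating) (∧-projˡ (proj₂ separating)) (∧-projʳ {ann U (proj₁ separating)} (proj₂ separating)))) |W⊥|

  W⊥-closed : Closed W⊥
  W⊥-closed = kernel-closed (ann U) (λ c → dot c w) (ann-closed U) (λ u v → dot-linearˡ u v w)

  W⊥-annihilates : ∀ c v → W⊥ c ≡ true → W v ≡ true → dot c v ≡ false
  W⊥-annihilates c v h Wv with U v in e
  ... | true = ann-sound U c v (∧-projˡ h) e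
  ... | false = trans (cong (dot c) (sym (⊕-cancel v w))) (trans (dot-linearʳ c (v ⊕ w) w)
      (xor-false (ann-sound U c (v ⊕ w) (∧-projˡ h) (coset v Wv e)) (not-true (∧-projʳ {ann U c} h))))

  pointsIn-W : ∀ a b → pointsIn W a b ≡ pointsIn fresh a b + pointsIn U a b
  pointsIn-W a b = begin
    ind (W a) + ind (W b) + ind (W (a ⊕ b))
      ≡⟨ cong₂ _+_ (cong₂ _+_ (split a) (split b)) (split (a ⊕ b)) ⟩
    (ind (fresh a) + ind (U a)) + (ind (fresh b) + ind (U b)) + (ind (fresh (a ⊕ b)) + ind (U (a ⊕ b)))
      ≡⟨ cong (_+ (ind (fresh (a ⊕ b)) + ind (U (a ⊕ b)))) (+-interchange (ind (fresh a)) _ _ _) ⟩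
    (ind (fresh a) + ind (fresh b)) + (ind (U a) + ind (U b)) + (ind (fresh (a ⊕ b)) + ind (U (a ⊕ b)))
      ≡⟨ +-interchange (ind (fresh a) + ind (fresh b)) _ _ _ ⟩
    pointsIn fresh a b + pointsIn U a b ∎
    where
    open ≡-Reasoning
    split : ∀ v → ind (W v) ≡ ind (fresh v) + ind (U v)
    split v with U v in e
    ... | true rewrite U⊆W v e = refl
    ... | false with W v
    ...   | true = refl
    ...   | false = refl

  -- a line {a, b, a ⊕ b} without points in W ∖ U spans with U a subspace
  -- missing w: otherwise w or w ⊕ (a point of the line) would lie in U
  w∉U+line : ∀ a b → fresh a ≡ false → fresh b ≡ false → fresh (a ⊕ b) ≡ false → span (span U a) b w ≡ false
  w∉U+line a b fa fb fab = ¬-not absurd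
    where
    absurd : span (span U a) b w ≡ true → ⊥
    absurd h with ∨-elim {span U a w} h
    ... | inj₁ h₁ with ∨-elim {U w} h₁
    ...   | inj₁ e = true≢false (trans (sym e) w∉U)
    ...   | inj₂ e = true≢false (trans (sym (fresh-from-coset a e)) fa)
    absurd h | inj₂ h₂ with ∨-elim {U (w ⊕ b)} h₂
    ...   | inj₁ e = true≢false (trans (sym (fresh-from-coset b e)) fb)
    ...   | inj₂ e = true≢false (trans (sym (fresh-from-coset (a ⊕ b)
              (subst (λ s → U s ≡ true) (trans (⊕-assoc w b a) (cong (w ⊕_) (⊕-comm b a))) e))) fab)

sumL-tabulate : ∀ {m} {A : Set} (f : A → ℕ) (g : Fin m → A) →
  sumL f (tabulate g) ≡ sumL (λ x → f (g x)) (allFin m)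
sumL-tabulate {zero} f g = refl
sumL-tabulate {suc m} f g = cong (f (g fzero) +_)
  (trans (sumL-tabulate f (λ x → g (fsuc x))) (sym (sumL-tabulate (λ x → f (g x)) fsuc)))

sumL-allFin-suc : ∀ {m} (f : Fin (suc m) → ℕ) →
  sumL f (allFin (suc m)) ≡ f fzero + sumL (λ x → f (fsuc x)) (allFin m)
sumL-allFin-suc f = cong (f fzero +_) (sumL-tabulate f fsuc)

except : ∀ {m} → Fin m → (Fin m → ℕ) → Fin m → ℕ
except fzero f fzero = 0
except fzero f (fsuc x) = f (fsuc x)
except (fsuc i) f fzero = f fzero
except (fsuc i) f (fsuc x) = except i (λ y → f (fsuc y)) x

except-≢ : ∀ {m} (i j : Fin m) (f : Fin m → ℕ) → i ≢ j → except i f j ≡ f j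
except-≢ fzero fzero f i≢j = ⊥-elim (i≢j refl)
except-≢ fzero (fsuc j) f _ = refl
except-≢ (fsuc i) fzero f _ = refl
except-≢ (fsuc i) (fsuc j) f i≢j = except-≢ i j (λ y → f (fsuc y)) (λ e → i≢j (cong fsuc e))

sumL-pick : ∀ {m} (f : Fin m → ℕ) (i : Fin m) → sumL f (allFin m) ≡ f i + sumL (except i f) (allFin m)
sumL-pick {suc m} f fzero = trans (sumL-allFin-suc f) (cong (f fzero +_) (sym (sumL-allFin-suc (except fzero f))))
sumL-pick {suc m} f (fsuc i) = begin
  sumL f (allFin (suc m))
    ≡⟨ sumL-allFin-suc f ⟩
  f fzero + sumL f' (allFin m)
    ≡⟨ cong (f fzero +_) (sumL-pick f' i) ⟩
  f fzero + (f' i + sumL (except i f') (allFin m))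
    ≡⟨ sym (+-assoc (f fzero) (f' i) _) ⟩
  f fzero + f' i + sumL (except i f') (allFin m)
    ≡⟨ cong (_+ sumL (except i f') (allFin m)) (+-comm (f fzero) (f' i)) ⟩
  f' i + f fzero + sumL (except i f') (allFin m)
    ≡⟨ +-assoc (f' i) (f fzero) _ ⟩
  f' i + (f fzero + sumL (except i f') (allFin m))
    ≡⟨ cong (f' i +_) (sym (sumL-allFin-suc (except (fsuc i) f))) ⟩
  f (fsuc i) + sumL (except (fsuc i) f) (allFin (suc m)) ∎
  where
  open ≡-Reasoning
  f' : Fin m → ℕ
  f' y = f (fsuc y)

sumL-distinct : ∀ {m} (f : Fin m → ℕ) (L : List (Fin m)) → Unique L → sumL f L ≤ sumL f (allFin m)
sumL-distinct f [] _ = z≤n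
sumL-distinct f (i ∷ L) (i∉L ∷ unique) = begin
  f i + sumL f L                       ≡⟨ cong (f i +_) (sym (unchanged L i∉L)) ⟩
  f i + sumL (except i f) L            ≤⟨ +-monoʳ-≤ (f i) (sumL-distinct (except i f) L unique) ⟩
  f i + sumL (except i f) (allFin _)   ≡⟨ sym (sumL-pick f i) ⟩
  sumL f (allFin _)                    ∎
  where
  open ≤-Reasoning
  unchanged : ∀ L → All (i ≢_) L → sumL (except i f) L ≡ sumL f L
  unchanged [] [] = refl
  unchanged (j ∷ L) (i≢j ∷ rest) = cong₂ _+_ (except-≢ i j f i≢j) (unchanged L rest)


linesInKernel : ∀ {n m} (a b : Fin m → Vec Bool n) → Vec Bool n → ℕ
linesInKernel {m = m} a b c = count (λ x → Kills (a x) (b x) c) (allFin m)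

killersIn : ∀ {n m} (a b : Fin m → Vec Bool n) → (Vec Bool n → Bool) → Fin m → ℕ
killersIn {n} a b P x = count (λ c → P c ∧ Kills (a x) (b x) c) (allVecs n)

incidences : ∀ {n m} (a b : Fin m → Vec Bool n) (P : Vec Bool n → Bool) →
  sumL (λ c → if P c then linesInKernel a b c else 0) (allVecs n) ≡ sumL (killersIn a b P) (allFin m)
incidences {n} {m} a b P = begin
  sumL (λ c → if P c then linesInKernel a b c else 0) V
    ≡⟨ sumL-ext restrict V ⟩
  sumL (λ c → sumL (λ x → ind (P c ∧ Kills (a x) (b x) c)) F) V
    ≡⟨ sumL-swap (λ c x → ind (P c ∧ Kills (a x) (b x) c)) V F ⟩
  sumL (λ x → sumL (λ c → ind (P c ∧ Kills (a x) (b x) c)) V) F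
    ≡⟨ sumL-ext (λ x → sym (count-ind _ V)) F ⟩
  sumL (killersIn a b P) F ∎
  where
  open ≡-Reasoning
  V : List (Vec Bool n)
  V = allVecs n
  F : List (Fin m)
  F = allFin m
  restrict : ∀ c → (if P c then linesInKernel a b c else 0) ≡ sumL (λ x → ind (P c ∧ Kills (a x) (b x) c)) F
  restrict c with P c
  ... | true = count-ind _ F
  ... | false = sym (sumL-zero F)

incidence-bound : ∀ {n m} (a b : Fin m → Vec Bool n) (B : ℕ) →
  (∀ c → isZero c ≡ false → linesInKernel a b c ≤ B) → (P : Vec Bool n → Bool) →
  sumL (killersIn a b P) (allFin m) ≤
    B * count (λ c → P c ∧ not (isZero c)) (allVecs n) + m * count (λ c → P c ∧ isZero c) (allVecs n)
incidence-bound {n} {m} a b B bound P = begin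
  sumL (killersIn a b P) (allFin m)
    ≡⟨ sym (incidences a b P) ⟩
  sumL (λ c → if P c then linesInKernel a b c else 0) V
    ≤⟨ sumL-mono per-functional V ⟩
  sumL (λ c → B * ind (P c ∧ not (isZero c)) + m * ind (P c ∧ isZero c)) V
    ≡⟨ sumL-+ _ _ V ⟩
  sumL (λ c → B * ind (P c ∧ not (isZero c))) V + sumL (λ c → m * ind (P c ∧ isZero c)) V
    ≡⟨ cong₂ _+_ (trans (sumL-* B _ V) (cong (B *_) (sym (count-ind _ V))))
                 (trans (sumL-* m _ V) (cong (m *_) (sym (count-ind _ V)))) ⟩
  B * count (λ c → P c ∧ not (isZero c)) V + m * count (λ c → P c ∧ isZero c) V ∎
  where
  open ≤-Reasoning
  V : List (Vec Bool n)
  V = allVecs n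
  per-functional : ∀ c → (if P c then linesInKernel a b c else 0) ≤
                         B * ind (P c ∧ not (isZero c)) + m * ind (P c ∧ isZero c)
  per-functional c with P c | isZero c in e
  ... | false | _ = z≤n
  ... | true | true = ≤-trans (count-≤-length _ (allFin m))
                        (≤-reflexive (trans (length-tabulate (λ x → x)) (sym (cong₂ _+_ (*-zeroʳ B) (*-identityʳ m)))))
  ... | true | false = ≤-trans (bound c e) (≤-reflexive (sym (trans (cong₂ _+_ (*-identityʳ B) (*-zeroʳ m)) (+-identityʳ B))))


onLineThrough : ∀ {n} → Vec Bool n → Vec Bool n → Vec Bool n → Bool
onLineThrough a b v = eqV v a ∨ eqV v b ∨ eqV v (a ⊕ b)

anyOf : ∀ {A : Set} → (A → Bool) → List A → Bool
anyOf p [] = false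
anyOf p (x ∷ xs) = p x ∨ anyOf p xs

anyOf-witness : ∀ {A : Set} (p : A → Bool) xs → anyOf p xs ≡ true → Σ A (λ x → p x ≡ true)
anyOf-witness p (x ∷ xs) e with p x in e'
... | true = x , e'
... | false = anyOf-witness p xs e

anyOf-intro : ∀ {A : Set} (p : A → Bool) {x} xs → x ∈ xs → p x ≡ true → anyOf p xs ≡ true
anyOf-intro p (y ∷ xs) (here refl) e = ∨-introˡ e
anyOf-intro p (y ∷ xs) (there m) e = ∨-introʳ {p y} (anyOf-intro p xs m e)

count-anyOf : ∀ {A B : Set} (P : A → Bool) (Q : B → A → Bool) ys vs →
  count (λ v → P v ∧ anyOf (λ x → Q x v) ys) vs ≤ sumL (λ x → count (λ v → P v ∧ Q x v) vs) ys
count-anyOf P Q [] vs = ≤-reflexive (trans (count-ext (λ v → ∧-zeroʳ (P v)) vs) (count-false vs))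
count-anyOf P Q (y ∷ ys) vs = ≤-trans (count-∨ P (Q y) (λ v → anyOf (λ x → Q x v) ys) vs)
  (+-monoʳ-≤ _ (count-anyOf P Q ys vs))

count-onLine : ∀ {n} (P : Vec Bool n → Bool) (a b : Vec Bool n) →
  count (λ v → P v ∧ onLineThrough a b v) (allVecs n) ≤ pointsIn P a b
count-onLine {n} P a b = begin
  count (λ v → P v ∧ onLineThrough a b v) V
    ≤⟨ count-∨ P (λ v → eqV v a) (λ v → eqV v b ∨ eqV v (a ⊕ b)) V ⟩
  count (λ v → P v ∧ eqV v a) V + count (λ v → P v ∧ (eqV v b ∨ eqV v (a ⊕ b))) V
    ≤⟨ +-monoʳ-≤ _ (count-∨ P (λ v → eqV v b) (λ v → eqV v (a ⊕ b)) V) ⟩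
  count (λ v → P v ∧ eqV v a) V + (count (λ v → P v ∧ eqV v b) V + count (λ v → P v ∧ eqV v (a ⊕ b)) V)
    ≡⟨ cong₂ _+_ (only a) (cong₂ _+_ (only b) (only (a ⊕ b))) ⟩
  ind (P a) + (ind (P b) + ind (P (a ⊕ b)))
    ≡⟨ sym (+-assoc (ind (P a)) _ _) ⟩
  pointsIn P a b ∎
  where
  open ≤-Reasoning
  V : List (Vec Bool n)
  V = allVecs n
  only : ∀ y → count (λ v → P v ∧ eqV v y) V ≡ ind (P y)
  only y = trans (count-ext (λ v → ∧-comm (P v) (eqV v y)) V) (count-singleton y P)

ten-incidences : ∀ {n m} (Z : Vec Bool n → Bool) → Closed Z → (a b : Fin m → Vec Bool n) →
  (i j k t : Fin m) → Unique (i ∷ j ∷ k ∷ t ∷ []) →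
  (Z (a i) ∧ Z (b i)) ≡ true → (Z (a j) ∧ Z (b j)) ≡ true → (Z (a k) ∧ Z (b k)) ≡ true →
  (p : Vec Bool n) → Z p ≡ true → onLineThrough (a t) (b t) p ≡ true →
  10 ≤ sumL (λ x → pointsIn Z (a x) (b x)) (allFin m)
ten-incidences Z Z-closed a b i j k t distinct ℓi ℓj ℓk p Zp p∈ℓt =
  ≤-trans four (sumL-distinct on (i ∷ j ∷ k ∷ t ∷ []) distinct)
  where
  on : _ → ℕ
  on x = pointsIn Z (a x) (b x)
  whole-line : ∀ x → (Z (a x) ∧ Z (b x)) ≡ true → on x ≡ 3
  whole-line x h rewrite ∧-projˡ {Z (a x)} h | ∧-projʳ {Z (a x)} h
    | Z-closed (a x) (b x) (∧-projˡ h) (∧-projʳ {Z (a x)} h) = refl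
  one-point : onLineThrough (a t) (b t) p ≡ true → 1 ≤ on t + 0
  one-point h = subst (1 ≤_) (sym (+-identityʳ (on t))) (some-point (point-in-Z h))
    where
    Zat : ∀ y → eqV p y ≡ true → Z y ≡ true
    Zat y e = subst (λ v → Z v ≡ true) (eqV-sound p y e) Zp
    point-in-Z : onLineThrough (a t) (b t) p ≡ true →
                 Z (a t) ≡ true ⊎ Z (b t) ≡ true ⊎ Z (a t ⊕ b t) ≡ true
    point-in-Z h with ∨-elim {eqV p (a t)} h
    ... | inj₁ e = inj₁ (Zat (a t) e)
    ... | inj₂ h' with ∨-elim {eqV p (b t)} h'
    ...   | inj₁ e = inj₂ (inj₁ (Zat (b t) e))
    ...   | inj₂ e = inj₂ (inj₂ (Zat (a t ⊕ b t) e))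
    some-point : ∀ {x y z : Bool} → x ≡ true ⊎ y ≡ true ⊎ z ≡ true → 1 ≤ ind x + ind y + ind z
    some-point {true} _ = s≤s z≤n
    some-point {false} {true} _ = s≤s z≤n
    some-point {false} {false} {true} _ = s≤s z≤n
    some-point {false} {false} {false} (inj₁ ())
    some-point {false} {false} {false} (inj₂ (inj₁ ()))
    some-point {false} {false} {false} (inj₂ (inj₂ ()))
  four : 10 ≤ on i + (on j + (on k + (on t + 0)))
  four rewrite whole-line i ℓi | whole-line j ℓj | whole-line k ℓk = +-monoʳ-≤ 9 (one-point p∈ℓt)

dot-zeroˡ : ∀ {n} (v : Vec Bool n) → dot (0ᵥ n) v ≡ false
dot-zeroˡ {n} v = trans (dot-comm (0ᵥ n) v) (dot-zeroʳ v)

sum-doubled : (g : Fin 15 → ℕ) → sumL (λ x → 2 * (1 + g x)) (allFin 15) ≡ 2 * (15 + sumL g (allFin 15))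
sum-doubled g = trans (sumL-* 2 (λ x → 1 + g x) (allFin 15))
  (cong (2 *_) (trans (sumL-+ (λ _ → 1) g (allFin 15)) (cong (_+ sumL g (allFin 15)) (sumL-const 1 (allFin 15)))))

count-⊆-split : ∀ {A : Set} (U W C : A → Bool) → (∀ v → U v ≡ true → W v ≡ true) → ∀ xs →
  count (λ v → W v ∧ C v) xs ≡ count (λ v → U v ∧ C v) xs + count (λ v → (W v ∧ not (U v)) ∧ C v) xs
count-⊆-split U W C U⊆W [] = refl
count-⊆-split U W C U⊆W (x ∷ xs) with U x in e | W x in e' | C x
... | true  | false | _     = ⊥-elim (true≢false (trans (sym (U⊆W x e)) e'))
... | true  | true  | true  = cong suc (count-⊆-split U W C U⊆W xs)
... | false | true  | true  = trans (cong suc (count-⊆-split U W C U⊆W xs)) (sym (+-suc _ _))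
... | true  | true  | false = count-⊆-split U W C U⊆W xs
... | false | true  | false = count-⊆-split U W C U⊆W xs
... | false | false | _     = count-⊆-split U W C U⊆W xs

module Configuration {n : ℕ} (2ⁿ≡1024 : 2 ^ n ≡ 1024)
  (a b : Fin 15 → Vec Bool n)
  (a≢0 : ∀ x → isZero (a x) ≡ false) (b≢0 : ∀ x → isZero (b x) ≡ false) (a≢b : ∀ x → eqV (a x) (b x) ≡ false)
  (at-most-six : ∀ c → isZero c ≡ false → linesInKernel a b c ≤ 6)
  (U W : Vec Bool n → Bool) (U0 : U (0ᵥ n) ≡ true) (U-closed : Closed U) (|U| : count U (allVecs n) ≡ 64)
  (W-closed : Closed W) (|W| : count W (allVecs n) ≡ 128) (U⊆W : ∀ v → U v ≡ true → W v ≡ true)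
  (codepoint : Vec Bool n → Bool)
  (codepoint-def : ∀ v → codepoint v ≡ (not (isZero v) ∧ anyOf (λ x → onLineThrough (a x) (b x) v) (allFin 15)))
  where

  open Flag 2ⁿ≡1024 U W U0 U-closed |U| W-closed |W| U⊆W

  F : List (Fin 15)

  F = allFin 15

  on : (Vec Bool n → Bool) → Fin 15 → ℕ
  on Z x = pointsIn Z (a x) (b x)

  newCodepoints : ℕ
  newCodepoints = count (λ v → fresh v ∧ codepoint v) V

  weight-split : count (λ v → W v ∧ codepoint v) V ≡ count (λ v → U v ∧ codepoint v) V + newCodepoints
  weight-split = count-⊆-split U W codepoint U⊆W V

  0∈W⊥ : count (λ c → W⊥ c ∧ isZero c) V ≡ 1
  0∈W⊥ = trans (count-zero-vector W⊥)
    (cong ind (cong₂ (λ s t → s ∧ not t) (ann-complete U (0ᵥ n) (λ v _ → dot-zeroˡ v)) (dot-zeroˡ w)))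

  0∉U⊥∖W⊥ : count (λ c → U⊥∖W⊥ c ∧ isZero c) V ≡ 0
  0∉U⊥∖W⊥ = trans (count-zero-vector U⊥∖W⊥) (cong ind (trans (cong (ann U (0ᵥ n) ∧_) (dot-zeroˡ w)) (∧-zeroʳ _)))

  nonzero-in : ∀ (P : Vec Bool n → Bool) {k z} → count P V ≡ z + k → count (λ c → P c ∧ isZero c) V ≡ z →
    count (λ c → P c ∧ not (isZero c)) V ≡ k
  nonzero-in P {k} {z} |P| zeros = +-cancelˡ-≡ z _ k (trans (cong (_+ _) (sym zeros)) (trans (sym (count-split P isZero V)) |P|))

  through-W : ∀ x → 2 * (1 + on W x) ≤ killersIn a b W⊥ x
  through-W x = line-lemma W⊥ W 2 W⊥-closed |W⊥| W⊥-annihilates (a x) (b x)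

  -- and these 8 hyperplanes (one of them improper) carry ≤ 6·7 + 15 incidences
  incidences-through-W : sumL (killersIn a b W⊥) F ≤ 57
  incidences-through-W = ≤-trans (incidence-bound a b 6 at-most-six W⊥)
    (≤-reflexive (cong₂ (λ r s → 6 * r + 15 * s) (nonzero-in W⊥ {7} {1} |W⊥| 0∈W⊥) 0∈W⊥))

  upper-bound : 10 ≤ sumL (on U) F → sumL (on fresh) F ≤ 3
  upper-bound ten with sumL (on fresh) F ≤? 3
  ... | yes ≤3 = ≤3
  ... | no >3 = ⊥-elim (<-irrefl refl (≤-trans (58≤ (≰⇒> >3)) incidences-through-W))
    where
    open ≤-Reasoning
    58≤ : 4 ≤ sumL (on fresh) F → 58 ≤ sumL (killersIn a b W⊥) F
    58≤ four = begin
      58                                                    ≤⟨ *-monoʳ-≤ 2 (+-monoʳ-≤ 15 (+-mono-≤ four ten)) ⟩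
      2 * (15 + (sumL (on fresh) F + sumL (on U) F))        ≡⟨ cong (λ s → 2 * (15 + s)) (sym (sumL-+ (on fresh) (on U) F)) ⟩
      2 * (15 + sumL (λ x → on fresh x + on U x) F)         ≡⟨ cong (λ s → 2 * (15 + s)) (sym (sumL-ext (λ x → pointsIn-W (a x) (b x)) F)) ⟩
      2 * (15 + sumL (on W) F)                              ≡⟨ sym (sum-doubled (on W)) ⟩
      sumL (λ x → 2 * (1 + on W x)) F                       ≤⟨ sumL-mono through-W F ⟩
      sumL (killersIn a b W⊥) F                             ∎

  -- A codeline without points in W ∖ U spans with U a subspace S missing w, so
  -- some c ∈ S^⊥ ⊆ U^⊥ kills it with c·w = 1; such c make up half of the killers in U^⊥.
  through-U-not-W : ∀ x → fresh (a x) ≡ false → fresh (b x) ≡ false → fresh (a x ⊕ b x) ≡ false →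
    2 * (1 + on U x) ≤ killersIn a b U⊥∖W⊥ x
  through-U-not-W x fa fb fab = *-cancelˡ-≤ 2 (begin
      2 * (2 * (1 + on U x))                 ≡⟨ sym (*-assoc 2 2 (1 + on U x)) ⟩
      4 * (1 + on U x)                       ≤⟨ line-lemma (ann U) U 4 (ann-closed U) |U⊥| (λ c v h → ann-sound U c v h) (a x) (b x) ⟩
      count B V                              ≡⟨ kernel-half B (λ c → dot c w) B-closed (λ u v → dot-linearˡ u v w) c (∧-projˡ c∈B) (∧-projʳ {B c} c∈B) ⟩
      2 * count (λ c → B c ∧ not (dot c w)) V ≡⟨ cong (2 *_) (fibres-equal B (λ c → dot c w) B-closed (λ u v → dot-linearˡ u v w) c (∧-projˡ c∈B) (∧-projʳ {B c} c∈B)) ⟩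
      2 * count (λ c → B c ∧ dot c w) V      ≡⟨ cong (2 *_) (count-ext reorder V) ⟩
      2 * killersIn a b U⊥∖W⊥ x              ∎)
    where
    open ≤-Reasoning
    -- the functionals of U^⊥ killing ℓₓ, i.e. the annihilator of S = U + ⟨a, b⟩
    B : Vec Bool n → Bool
    B c = ann U c ∧ Kills (a x) (b x) c
    B-closed : Closed B
    B-closed = killers-closed (ann U) (ann-closed U) (a x) (b x)
    S : Vec Bool n → Bool
    S = span (span U (a x)) (b x)
    S⊥ : ∀ c → ann S c ≡ B c
    S⊥ c = trans (ann-span (span U (a x)) (b x) (span-zero U (a x) U0) c)
      (trans (cong (_∧ not (dot c (b x))) (ann-span U (a x) U0 c)) (∧-assoc (ann U c) _ _))
    separator : Σ (Vec Bool n) (λ c → (ann S c ∧ dot c w) ≡ true)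
    separator = separating-functional S w (span-closed (span U (a x)) (b x) (span-closed U (a x) U-closed))
                  (span-zero (span U (a x)) (b x) (span-zero U (a x) U0)) (w∉U+line (a x) (b x) fa fb fab)
    c : Vec Bool n
    c = proj₁ separator
    c∈B : (B c ∧ dot c w) ≡ true
    c∈B = subst (λ t → (t ∧ dot c w) ≡ true) (S⊥ c) (proj₂ separator)
    reorder : ∀ c → (B c ∧ dot c w) ≡ (U⊥∖W⊥ c ∧ Kills (a x) (b x) c)
    reorder c = trans (∧-assoc (ann U c) _ _) (trans (cong (ann U c ∧_) (∧-comm (Kills (a x) (b x) c) (dot c w)))
                  (sym (∧-assoc (ann U c) _ _)))

  incidences-through-U-not-W : sumL (killersIn a b U⊥∖W⊥) F ≤ 48
  incidences-through-U-not-W = ≤-trans (incidence-bound a b 6 at-most-six U⊥∖W⊥)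
    (≤-reflexive (cong₂ (λ r s → 6 * r + 15 * s) (nonzero-in U⊥∖W⊥ {8} {0} |U⊥∖W⊥| 0∉U⊥∖W⊥) 0∉U⊥∖W⊥))

  lower-bound : 10 ≤ sumL (on U) F →
    (∀ x → fresh (a x) ≡ false × fresh (b x) ≡ false × fresh (a x ⊕ b x) ≡ false) → ⊥
  lower-bound ten none = <-irrefl refl (≤-trans (≤-trans (n≤1+n 49) 50≤) incidences-through-U-not-W)
    where
    open ≤-Reasoning
    50≤ : 50 ≤ sumL (killersIn a b U⊥∖W⊥) F
    50≤ = begin
      50                                ≤⟨ *-monoʳ-≤ 2 (+-monoʳ-≤ 15 ten) ⟩
      2 * (15 + sumL (on U) F)          ≡⟨ sym (sum-doubled (on U)) ⟩
      sumL (λ x → 2 * (1 + on U x)) F   ≤⟨ sumL-mono (λ x → let (fa , fb , fab) = none x in through-U-not-W x fa fb fab) F ⟩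
      sumL (killersIn a b U⊥∖W⊥) F      ∎

  new-at-most : newCodepoints ≤ sumL (on fresh) F
  new-at-most = begin
    newCodepoints
      ≤⟨ count-mono (λ v h → ∧-intro (∧-projˡ h) (∧-projʳ {not (isZero v)} (trans (sym (codepoint-def v)) (∧-projʳ {fresh v} h)))) V ⟩
    count (λ v → fresh v ∧ anyOf (λ x → onLineThrough (a x) (b x) v) F) V
      ≤⟨ count-anyOf fresh (λ x v → onLineThrough (a x) (b x) v) F V ⟩
    sumL (λ x → count (λ v → fresh v ∧ onLineThrough (a x) (b x) v) V) F
      ≤⟨ sumL-mono (λ x → count-onLine fresh (a x) (b x)) F ⟩
    sumL (on fresh) F ∎
    where open ≤-Reasoning

  new-positive : ∀ x y → onLineThrough (a x) (b x) y ≡ true → isZero y ≡ false → fresh y ≡ true → 1 ≤ newCodepoints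
  new-positive x y y∈ℓ y≢0 fy = count-positive _ V (∈-allVecs y)
    (∧-intro fy (trans (codepoint-def y) (∧-intro (not-false y≢0) (anyOf-intro (λ z → onLineThrough (a z) (b z) y) F (∈-allFin x) y∈ℓ))))

  no-new-codepoints : newCodepoints ≡ 0 →
    ∀ x → fresh (a x) ≡ false × fresh (b x) ≡ false × fresh (a x ⊕ b x) ≡ false
  no-new-codepoints none x =
      not-fresh (a x) (∨-introˡ (eqV-refl (a x))) (a≢0 x)
    , not-fresh (b x) (∨-introʳ {eqV (b x) (a x)} (∨-introˡ (eqV-refl (b x)))) (b≢0 x)
    , not-fresh (a x ⊕ b x) (∨-introʳ {eqV (a x ⊕ b x) (a x)} (∨-introʳ {eqV (a x ⊕ b x) (b x)} (eqV-refl (a x ⊕ b x))))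
                (trans (isZero-⊕ (a x) (b x)) (a≢b x))
    where
    not-fresh : ∀ y → onLineThrough (a x) (b x) y ≡ true → isZero y ≡ false → fresh y ≡ false
    not-fresh y y∈ℓ y≢0 = ¬-not (λ fy → <-irrefl (sym none) (new-positive x y y∈ℓ y≢0 fy))

  new-codepoints : 10 ≤ sumL (on U) F → 1 ≤ newCodepoints × newCodepoints ≤ 3
  new-codepoints ten = n≢0⇒n>0 (λ none → lower-bound ten (no-new-codepoints none))
                     , ≤-trans new-at-most (upper-bound ten)


count-Vector : (p : Vector → Bool) (xs : List Vector) → count {A = Vector} p xs ≡ count {A = Vec Bool 10} p xs
count-Vector p xs = refl

size-count : (p : Vector → Bool) → size p ≡ count {A = Vec Bool 10} p (allVecs 10)
size-count p = count-Vector p (allVecs 10)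

weight-count : ∀ {d} (M : Multiset15) (S : Subspace d) →
  weight {d} M S ≡ count {A = Vec Bool 10} (λ v → proj₁ S v ∧ isCodepoint M v) (allVecs 10)
weight-count M S = count-Vector (λ v → proj₁ S v ∧ isCodepoint M v) (allVecs 10)

kernelOf : Vector → Vector → Bool
kernelOf c v = not (dot c v)

hyperplane : (c : Vector) → isZero c ≡ false → Subspace 9
hyperplane c c≢0 = kernelOf c , cong not (dot-zeroʳ c) , closed , size-512
  where
  closed : ∀ u v → kernelOf c u ≡ true → kernelOf c v ≡ true → kernelOf c (u ⊕ v) ≡ true
  closed u v hu hv = not-false (trans (dot-linearʳ c u v) (xor-false (not-true hu) (not-true hv)))
  size-512 : size (kernelOf c) ≡ 2 ^ 9
  size-512 = trans (size-count (kernelOf c)) (*-cancelʳ-≡ (count {A = Vec Bool 10} (kernelOf c) (allVecs 10)) (2 ^ 9) 2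
    (kernel-size-nonzero {10} c (kernelOf c) (λ v → refl) c≢0))

one-two-three : ∀ {u w N} → w ≡ u + N → 1 ≤ N → N ≤ 3 → (w ≡ u + 1) ⊎ (w ≡ u + 2) ⊎ (w ≡ u + 3)
one-two-three {N = 1} e _ _ = inj₁ e
one-two-three {N = 2} e _ _ = inj₂ (inj₁ e)
one-two-three {N = 3} e _ _ = inj₂ (inj₂ e)
one-two-three {N = suc (suc (suc (suc _)))} _ _ (s≤s (s≤s (s≤s ())))

-- The codelines i, j, k and the codeline t through the isolated codepoint p
-- are four distinct codelines meeting U in 3 + 3 + 3 + (≥ 1) points; the
-- configuration argument then bounds the new codepoints of W.
lemma3p3 : (M : Multiset15)
    → ((H : Subspace 9) → linesIn {9} M H ≤ 6)
    → (U : Subspace 6)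
    → weight {6} M U ≡ 10
    → (i j k : Fin 15) → i ≢ j → i ≢ k → j ≢ k
    → lineIn {6} (M i) U ≡ true → lineIn {6} (M j) U ≡ true → lineIn {6} (M k) U ≡ true
    → Σ Vector (λ p → mem {6} U p ≡ true × isCodepoint M p ≡ true
        × onLine (M i) p ≡ false × onLine (M j) p ≡ false × onLine (M k) p ≡ false)
    → (W : Subspace 7) → _⊆_ {6} {7} U W
    → (weight {7} M W ≡ weight {6} M U + 1)
      ⊎ (weight {7} M W ≡ weight {6} M U + 2)
      ⊎ (weight {7} M W ≡ weight {6} M U + 3)
lemma3p3 M hyp U _ i j k i≢j i≢k j≢k ℓi ℓj ℓk (p , p∈U , p-codepoint , p∉ℓi , p∉ℓj , p∉ℓk) W U⊆W =
  one-two-three (trans (weight-count {7} M W) (trans weight-split (cong (_+ newCodepoints) (sym (weight-count {6} M U)))))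
    (proj₁ bounds) (proj₂ bounds)
  where
  a b : Fin 15 → Vector
  a x = pa (M x)
  b x = pb (M x)
  open Configuration refl a b (λ x → pa≠0 (M x)) (λ x → pb≠0 (M x)) (λ x → pa≠pb (M x))
    (λ c c≢0 → hyp (hyperplane c c≢0))
    (proj₁ U) (proj₁ W) (proj₁ (proj₂ U)) (proj₁ (proj₂ (proj₂ U))) (trans (sym (size-count (proj₁ U))) (proj₂ (proj₂ (proj₂ U))))
    (proj₁ (proj₂ (proj₂ W))) (trans (sym (size-count (proj₁ W))) (proj₂ (proj₂ (proj₂ W)))) U⊆W
    (isCodepoint M) (λ v → refl)
  t-spec : Σ (Fin 15) (λ x → onLineThrough (a x) (b x) p ≡ true)
  t-spec = anyOf-witness (λ x → onLineThrough (a x) (b x) p) (allFin 15) (∧-projʳ {not (isZero p)} p-codepoint)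
  t : Fin 15
  t = proj₁ t-spec
  ≢t : ∀ y → onLine (M y) p ≡ false → y ≢ t
  ≢t y p∉ℓy refl = true≢false (trans (sym (proj₂ t-spec)) p∉ℓy)
  distinct : Unique (i ∷ j ∷ k ∷ t ∷ [])
  distinct = (i≢j ∷ i≢k ∷ ≢t i p∉ℓi ∷ []) ∷ (j≢k ∷ ≢t j p∉ℓj ∷ []) ∷ (≢t k p∉ℓk ∷ []) ∷ [] ∷ []
  bounds : 1 ≤ newCodepoints × newCodepoints ≤ 3
  bounds = new-codepoints (ten-incidences (proj₁ U) (proj₁ (proj₂ (proj₂ U))) a b i j k t distinct ℓi ℓj ℓk p p∈U (proj₂ t-spec))
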